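{- Let $3\le k\le \ell$ be integers. Let $\overline{G}$ be the graph obtained as follows: start with the wheel $C_{k+1}\vee K_1$ with rim cycle $(w_1,\dots,w_{k+1},w_1)$ and hub $w_0$ (adjacent to all $w_1,\dots,w_{k+1}$); add a path $(v_1,\dots,v_{\ell-2})$ on new vertices, join every $v_i$ ($1\le i\le \ell-2$) to $w_2$, join $v_1$ to $w_1$ and join $v_{\ell-2}$ to $w_3$ (if $\ell=3$ then $v_1=v_{\ell-2}$ is adjacent to $w_1,w_2,w_3$). Let $G$ be the complement of $\overline{G}$. Then $\mathcal{I}(G)=\mathcal{A}(G)\cong\theta_{1,k,\ell}$.
   Context: For a graph $G$, an $i$-set is an independent dominating set of minimum cardinality and an $\alpha$-set is a maximum independent set. The $i$-graph $\mathcal{I}(G)$ has the $i$-sets as vertices, with $X\sim Y$ iff $Y=(X\setminus\{u\})\cup\{v\}$ for some $u\in X$, $v\notin X$ with $uv\in E(G)$; the $\alpha$-graph $\mathcal{A}(G)$ is defined the same way on the $\alpha$-sets. $\theta_{j,k,\ell}$ denotes two vertices joined by three internally vertex-disjoint paths of lengths $j,k,\ell$. -}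

module Defs where

open import Level using (0ℓ)
open import Data.Nat using (ℕ; zero; suc; _+_; _∸_; _≤_)
open import Data.Fin using (Fin; toℕ)
open import Data.Fin.Subset using (Subset; _∈_; _∉_; _∪_; _-_; ⁅_⁆; ∣_∣)
open import Data.Product using (_×_; ∃; Σ)
open import Data.Sum using (_⊎_)
open import Relation.Nullary using (¬_)
open import Relation.Binary.PropositionalEquality using (_≡_; _≢_)

Graph : ℕ → Set₁
Graph n = Fin n → Fin n → Set

module _ {n : ℕ} (E : Graph n) where

  Independent : Subset n → Set
  Independent X = ∀ u v → u ∈ X → v ∈ X → ¬ E u v

  Dominating : Subset n → Set
  Dominating X = ∀ v → v ∈ X ⊎ ∃ λ u → u ∈ X × E u v

  IndepDominating : Subset n → Set
  IndepDominating X = Independent X × Dominating X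

  IsISet : Subset n → Set
  IsISet X = IndepDominating X × (∀ Y → IndepDominating Y → ∣ X ∣ ≤ ∣ Y ∣)

  IsAlphaSet : Subset n → Set
  IsAlphaSet X = Independent X × (∀ Y → Independent Y → ∣ Y ∣ ≤ ∣ X ∣)

  SlideAdj : Subset n → Subset n → Set
  SlideAdj X Y = ∃ λ u → ∃ λ v → u ∈ X × v ∉ X × E u v × Y ≡ (X - u) ∪ ⁅ v ⁆

-- Base edges of Ḡ (on labels in ℕ), for parameters k ℓ.
-- Labels: 0 = w₀ (hub), i = wᵢ for 1 ≤ i ≤ k+1, k+1+j = vⱼ for 1 ≤ j ≤ ℓ-2.
data GbarEdge (k ℓ : ℕ) : ℕ → ℕ → Set where
  hub     : ∀ {b} → 1 ≤ b → b ≤ suc k → GbarEdge k ℓ 0 b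
  rim     : ∀ {a} → 1 ≤ a → a ≤ k → GbarEdge k ℓ a (suc a)
  rimEnd  : GbarEdge k ℓ 1 (suc k)
  path    : ∀ {a} → suc (suc k) ≤ a → suc a ≤ k + ℓ ∸ 1 → GbarEdge k ℓ a (suc a)
  toW2    : ∀ {b} → suc (suc k) ≤ b → b ≤ k + ℓ ∸ 1 → GbarEdge k ℓ 2 b
  v1w1    : GbarEdge k ℓ 1 (suc (suc k))
  vlastW3 : GbarEdge k ℓ 3 (k + ℓ ∸ 1)

GbarAdj : (k ℓ : ℕ) → Graph (k + ℓ)
GbarAdj k ℓ u v = GbarEdge k ℓ (toℕ u) (toℕ v) ⊎ GbarEdge k ℓ (toℕ v) (toℕ u)

GAdj : (k ℓ : ℕ) → Graph (k + ℓ)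
GAdj k ℓ u v = u ≢ v × ¬ GbarAdj k ℓ u v

-- θ_{1,k,ℓ} on k + ℓ vertices: 0 and 1 are the two branch vertices;
-- path of length k: 0 - 2 - 3 - … - k - 1 ; path of length ℓ: 0 - (k+1) - … - (k+ℓ-1) - 1 ;
-- path of length 1: the edge 0 - 1.
data ThetaEdge (k ℓ : ℕ) : ℕ → ℕ → Set where
  direct : ThetaEdge k ℓ 0 1
  kStart : ThetaEdge k ℓ 0 2
  kStep  : ∀ {a} → 2 ≤ a → suc a ≤ k → ThetaEdge k ℓ a (suc a)
  kEnd   : ThetaEdge k ℓ k 1
  lStart : ThetaEdge k ℓ 0 (suc k)
  lStep  : ∀ {a} → suc k ≤ a → suc a ≤ k + ℓ ∸ 1 → ThetaEdge k ℓ a (suc a)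
  lEnd   : ThetaEdge k ℓ (k + ℓ ∸ 1) 1

ThetaAdj : (k ℓ : ℕ) → Graph (k + ℓ)
ThetaAdj k ℓ u v = ThetaEdge k ℓ (toℕ u) (toℕ v) ⊎ ThetaEdge k ℓ (toℕ v) (toℕ u)

module Submission where

open import Defs
open import Data.Bool using (Bool; true; false)
open import Data.Empty using (⊥; ⊥-elim)
open import Data.Fin using (Fin; zero; toℕ; fromℕ<)
open import Data.Fin.Properties using (toℕ-injective; toℕ<n; toℕ-fromℕ<; any?) renaming (_≟_ to _≟ᶠ_)
open import Data.Fin.Subset using (Subset; _∈_; _∉_; _⊆_; _∪_; _─_; _-_; ⁅_⁆; ∣_∣)
open import Data.Fin.Subset.Properties
  using (_∈?_; ⊆-antisym; p⊆q⇒∣p∣≤∣q∣; p⊂q⇒∣p∣<∣q∣; q⊆p∪q; x∈p∪q⁺; x∈p∪q⁻; x∈⁅x⁆; x∈⁅y⁆⇒x≡y;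
         ∣⁅x⁆∣≡1; x∈p∧x≢y⇒x∈p-y; p─q⊆p)
open import Data.Nat using (ℕ; zero; suc; _+_; _∸_; _≤_; _<_; z≤n; s≤s; _≟_; _≤?_)
open import Data.Nat.Properties
open import Data.Product using (_×_; _,_; ∃; ∃₂; Σ; proj₁; proj₂)
open import Data.Sum using (_⊎_; inj₁; inj₂; [_,_]′)
open import Data.Vec using ([]; _∷_; tabulate)
open import Data.Vec.Base using (there)
open import Data.Vec.Properties using (lookup∘tabulate; []=⇒lookup; lookup⇒[]=)
open import Function using (_∘_)
open import Function.Bundles using (_⇔_; mk⇔)
open import Function.Definitions using (Injective)
open import Relation.Binary.PropositionalEquality
open import Relation.Nullary using (¬_; Dec; yes; no; does)
open import Relation.Nullary.Decidable using (_⊎-dec_; _×-dec_; ¬?; dec-true; dec-false; decidable-stable)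

-- G is the complement of Ḡ, so its independent sets are the cliques of Ḡ. Since Ḡ is K₄-free and
-- each of its vertices and edges lies in a triangle, every independent set of G lies inside one of the
-- k + ℓ triangles of Ḡ, which are therefore the maximal independent sets of G. All of them have three
-- vertices, so they are exactly the i-sets and exactly the α-sets. Two triangles are joined by a slide
-- iff they share an edge: the two swapped vertices are then non-adjacent in Ḡ because Ḡ has no K₄.
-- Numbering the triangles so that those around the hub form the k-path and those along the fan form
-- the ℓ-path of θ_{1,k,ℓ} turns edge sharing into adjacency in θ_{1,k,ℓ}.

private variable
  n : ℕ
  p : Subset n

x∈p─q⇒x∉q : ∀ (p q : Subset n) {x} → x ∈ p ─ q → x ∉ q
x∈p─q⇒x∉q (_ ∷ p) (true ∷ q) (there x∈) (there x∈q) = x∈p─q⇒x∉q p q x∈ x∈q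
x∈p─q⇒x∉q (_ ∷ p) (false ∷ q) (there x∈) (there x∈q) = x∈p─q⇒x∉q p q x∈ x∈q

x∈p-y⇒x≢y : ∀ {x y : Fin n} → x ∈ p - y → x ≢ y
x∈p-y⇒x≢y {p = p} {y = y} x∈ refl = x∈p─q⇒x∉q p ⁅ y ⁆ x∈ (x∈⁅x⁆ y)

x∈p-y⇒x∈p : ∀ {x y : Fin n} → x ∈ p - y → x ∈ p
x∈p-y⇒x∈p {p = p} {y = y} = p─q⊆p p ⁅ y ⁆

∣p∪q∣≤∣p∣+∣q∣ : ∀ (p q : Subset n) → ∣ p ∪ q ∣ ≤ ∣ p ∣ + ∣ q ∣
∣p∪q∣≤∣p∣+∣q∣ [] [] = z≤n
∣p∪q∣≤∣p∣+∣q∣ (true ∷ p) (true ∷ q) = s≤s (≤-trans (∣p∪q∣≤∣p∣+∣q∣ p q) (+-monoʳ-≤ ∣ p ∣ (n≤1+n _)))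
∣p∪q∣≤∣p∣+∣q∣ (true ∷ p) (false ∷ q) = s≤s (∣p∪q∣≤∣p∣+∣q∣ p q)
∣p∪q∣≤∣p∣+∣q∣ (false ∷ p) (true ∷ q) = ≤-trans (s≤s (∣p∪q∣≤∣p∣+∣q∣ p q)) (≤-reflexive (sym (+-suc ∣ p ∣ ∣ q ∣)))
∣p∪q∣≤∣p∣+∣q∣ (false ∷ p) (false ∷ q) = ∣p∪q∣≤∣p∣+∣q∣ p q

∣p∣<∣⁅x⁆∪p∣ : ∀ {x : Fin n} → x ∉ p → ∣ p ∣ < ∣ ⁅ x ⁆ ∪ p ∣
∣p∣<∣⁅x⁆∪p∣ {p = p} {x = x} x∉p = p⊂q⇒∣p∣<∣q∣ (q⊆p∪q ⁅ x ⁆ p , x , x∈p∪q⁺ (inj₁ (x∈⁅x⁆ x)) , x∉p)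

∣⁅x⁆∪⁅y⁆∪⁅z⁆∣≡3 : ∀ {x y z : Fin n} → x ≢ y → x ≢ z → y ≢ z → ∣ ⁅ x ⁆ ∪ ⁅ y ⁆ ∪ ⁅ z ⁆ ∣ ≡ 3
∣⁅x⁆∪⁅y⁆∪⁅z⁆∣≡3 {x = x} {y = y} {z = z} x≢y x≢z y≢z = ≤-antisym upper lower
  where
  upper : ∣ ⁅ x ⁆ ∪ ⁅ y ⁆ ∪ ⁅ z ⁆ ∣ ≤ 3
  upper = begin
    ∣ ⁅ x ⁆ ∪ ⁅ y ⁆ ∪ ⁅ z ⁆ ∣       ≤⟨ ∣p∪q∣≤∣p∣+∣q∣ ⁅ x ⁆ _ ⟩
    ∣ ⁅ x ⁆ ∣ + ∣ ⁅ y ⁆ ∪ ⁅ z ⁆ ∣   ≤⟨ +-monoʳ-≤ ∣ ⁅ x ⁆ ∣ (∣p∪q∣≤∣p∣+∣q∣ ⁅ y ⁆ ⁅ z ⁆) ⟩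
    ∣ ⁅ x ⁆ ∣ + (∣ ⁅ y ⁆ ∣ + ∣ ⁅ z ⁆ ∣) ≡⟨ cong₂ _+_ (∣⁅x⁆∣≡1 x) (cong₂ _+_ (∣⁅x⁆∣≡1 y) (∣⁅x⁆∣≡1 z)) ⟩
    3                                ∎
    where open ≤-Reasoning
  x∉ : x ∉ ⁅ y ⁆ ∪ ⁅ z ⁆
  x∉ x∈ with x∈p∪q⁻ ⁅ y ⁆ ⁅ z ⁆ x∈
  ... | inj₁ x∈y = x≢y (x∈⁅y⁆⇒x≡y y x∈y)
  ... | inj₂ x∈z = x≢z (x∈⁅y⁆⇒x≡y z x∈z)
  y∉ : y ∉ ⁅ z ⁆
  y∉ y∈z = y≢z (x∈⁅y⁆⇒x≡y z y∈z)
  lower : 3 ≤ ∣ ⁅ x ⁆ ∪ ⁅ y ⁆ ∪ ⁅ z ⁆ ∣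
  lower = begin
    3                            ≡⟨ cong (2 +_) (sym (∣⁅x⁆∣≡1 z)) ⟩
    2 + ∣ ⁅ z ⁆ ∣                ≤⟨ s≤s (∣p∣<∣⁅x⁆∪p∣ y∉) ⟩
    1 + ∣ ⁅ y ⁆ ∪ ⁅ z ⁆ ∣        ≤⟨ ∣p∣<∣⁅x⁆∪p∣ x∉ ⟩
    ∣ ⁅ x ⁆ ∪ ⁅ y ⁆ ∪ ⁅ z ⁆ ∣   ∎
    where open ≤-Reasoning

⊆∧∣⊇∣⇒≡ : ∀ {p q : Subset n} → p ⊆ q → ∣ q ∣ ≤ ∣ p ∣ → p ≡ q
⊆∧∣⊇∣⇒≡ {p = p} p⊆q ∣q∣≤∣p∣ = ⊆-antisym p⊆q q⊆p
  where
  q⊆p : _ ⊆ p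
  q⊆p {x} x∈q with x ∈? p
  ... | yes x∈p = x∈p
  ... | no x∉p = ⊥-elim (<⇒≱ (p⊂q⇒∣p∣<∣q∣ (p⊆q , x , x∈q , x∉p)) ∣q∣≤∣p∣)

module CoveringFamily
    {n N s : ℕ} (E : Graph n) (family : Fin N → Subset n)
    (family-indepDominating : ∀ a → IndepDominating E (family a))
    (∣family∣≡s : ∀ a → ∣ family a ∣ ≡ s)
    (family-covers : ∀ {X} → Independent E X → ∃ λ a → X ⊆ family a)
  where

  indepDominating⇒family : ∀ {X} → IndepDominating E X → ∃ λ a → family a ≡ X
  indepDominating⇒family {X} (indep , dominating) with family-covers indep
  ... | a , X⊆fa = a , ⊆-antisym fa⊆X X⊆fa
    where
    fa⊆X : family a ⊆ X
    fa⊆X {y} y∈fa with dominating y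
    ... | inj₁ y∈X = y∈X
    ... | inj₂ (x , x∈X , Exy) = ⊥-elim (proj₁ (family-indepDominating a) x y (X⊆fa x∈X) y∈fa Exy)

  alphaSet⇒family : ∀ {X} → IsAlphaSet E X → ∃ λ a → family a ≡ X
  alphaSet⇒family (indep , maximum) with family-covers indep
  ... | a , X⊆fa = a , sym (⊆∧∣⊇∣⇒≡ X⊆fa (maximum _ (proj₁ (family-indepDominating a))))

  family-isISet : ∀ a → IsISet E (family a)
  family-isISet a = family-indepDominating a , minimum
    where
    minimum : ∀ Y → IndepDominating E Y → ∣ family a ∣ ≤ ∣ Y ∣
    minimum Y indepDomY with indepDominating⇒family indepDomY
    ... | b , refl = ≤-reflexive (trans (∣family∣≡s a) (sym (∣family∣≡s b)))

  family-isAlphaSet : ∀ a → IsAlphaSet E (family a)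
  family-isAlphaSet a = proj₁ (family-indepDominating a) , maximum
    where
    maximum : ∀ Y → Independent E Y → ∣ Y ∣ ≤ ∣ family a ∣
    maximum Y indepY with family-covers indepY
    ... | b , Y⊆fb = ≤-trans (p⊆q⇒∣p∣≤∣q∣ Y⊆fb) (≤-reflexive (trans (∣family∣≡s b) (sym (∣family∣≡s a))))

  iSet⇔alphaSet : ∀ X → IsISet E X ⇔ IsAlphaSet E X
  iSet⇔alphaSet X = mk⇔ iSet⇒alphaSet alphaSet⇒iSet
    where
    iSet⇒alphaSet : IsISet E X → IsAlphaSet E X
    iSet⇒alphaSet (indepDomX , _) with indepDominating⇒family indepDomX
    ... | a , refl = family-isAlphaSet a
    alphaSet⇒iSet : IsAlphaSet E X → IsISet E X
    alphaSet⇒iSet alphaX with alphaSet⇒family alphaX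
    ... | a , refl = family-isISet a

Triple : Set
Triple = ℕ × ℕ × ℕ

infix 4 _∈₃_ _↭₃_ _≈₃_

_∈₃_ : ℕ → Triple → Set
x ∈₃ (a , b , c) = x ≡ a ⊎ x ≡ b ⊎ x ≡ c

pattern 1st = inj₁ refl
pattern 2nd = inj₂ (inj₁ refl)
pattern 3rd = inj₂ (inj₂ refl)

_∈₃?_ : ∀ x T → Dec (x ∈₃ T)
x ∈₃? (a , b , c) = x ≟ a ⊎-dec x ≟ b ⊎-dec x ≟ c

_≈₃_ : Triple → Triple → Set
T ≈₃ T′ = (∀ {x} → x ∈₃ T → x ∈₃ T′) × (∀ {x} → x ∈₃ T′ → x ∈₃ T)

data _↭₃_ : Triple → Triple → Set where
  abc : ∀ {a b c} → (a , b , c) ↭₃ (a , b , c)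
  acb : ∀ {a b c} → (a , b , c) ↭₃ (a , c , b)
  bac : ∀ {a b c} → (a , b , c) ↭₃ (b , a , c)
  bca : ∀ {a b c} → (a , b , c) ↭₃ (b , c , a)
  cab : ∀ {a b c} → (a , b , c) ↭₃ (c , a , b)
  cba : ∀ {a b c} → (a , b , c) ↭₃ (c , b , a)

↭₃-sym : ∀ {T T′} → T ↭₃ T′ → T′ ↭₃ T
↭₃-sym abc = abc
↭₃-sym acb = acb
↭₃-sym bac = bac
↭₃-sym bca = cab
↭₃-sym cab = bca
↭₃-sym cba = cba

↭₃⇒⊆₃ : ∀ {T T′ x} → T ↭₃ T′ → x ∈₃ T → x ∈₃ T′
↭₃⇒⊆₃ abc x∈ = x∈
↭₃⇒⊆₃ acb (inj₁ e) = inj₁ e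
↭₃⇒⊆₃ acb (inj₂ (inj₁ e)) = inj₂ (inj₂ e)
↭₃⇒⊆₃ acb (inj₂ (inj₂ e)) = inj₂ (inj₁ e)
↭₃⇒⊆₃ bac (inj₁ e) = inj₂ (inj₁ e)
↭₃⇒⊆₃ bac (inj₂ (inj₁ e)) = inj₁ e
↭₃⇒⊆₃ bac (inj₂ (inj₂ e)) = inj₂ (inj₂ e)
↭₃⇒⊆₃ bca (inj₁ e) = inj₂ (inj₂ e)
↭₃⇒⊆₃ bca (inj₂ (inj₁ e)) = inj₁ e
↭₃⇒⊆₃ bca (inj₂ (inj₂ e)) = inj₂ (inj₁ e)
↭₃⇒⊆₃ cab (inj₁ e) = inj₂ (inj₁ e)
↭₃⇒⊆₃ cab (inj₂ (inj₁ e)) = inj₂ (inj₂ e)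
↭₃⇒⊆₃ cab (inj₂ (inj₂ e)) = inj₁ e
↭₃⇒⊆₃ cba (inj₁ e) = inj₂ (inj₂ e)
↭₃⇒⊆₃ cba (inj₂ (inj₁ e)) = inj₂ (inj₁ e)
↭₃⇒⊆₃ cba (inj₂ (inj₂ e)) = inj₁ e

↭₃⇒≈₃ : ∀ {T T′} → T ↭₃ T′ → T ≈₃ T′
↭₃⇒≈₃ π = ↭₃⇒⊆₃ π , ↭₃⇒⊆₃ (↭₃-sym π)

≈₃-trans : ∀ {T T′ T″} → T ≈₃ T′ → T′ ≈₃ T″ → T ≈₃ T″
≈₃-trans (f , g) (f′ , g′) = f′ ∘ f , g ∘ g′

others : ∀ {x} (T : Triple) → x ∈₃ T → ℕ × ℕ
others (a , b , c) (inj₁ _) = b , c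
others (a , b , c) (inj₂ (inj₁ _)) = a , c
others (a , b , c) (inj₂ (inj₂ _)) = a , b

replace : ∀ {x} (T : Triple) → x ∈₃ T → ℕ → Triple
replace T x∈T v = proj₁ (others T x∈T) , proj₂ (others T x∈T) , v

others⊆ : ∀ {x} (T : Triple) (x∈T : x ∈₃ T) → proj₁ (others T x∈T) ∈₃ T × proj₂ (others T x∈T) ∈₃ T
others⊆ (_ , _ , _) (inj₁ _) = 2nd , 3rd
others⊆ (_ , _ , _) (inj₂ (inj₁ _)) = 1st , 3rd
others⊆ (_ , _ , _) (inj₂ (inj₂ _)) = 1st , 2nd

Distinct₃ : Triple → Set
Distinct₃ (a , b , c) = a ≢ b × a ≢ c × b ≢ c

replace-⊇ : ∀ {x y v} (T : Triple) (x∈T : x ∈₃ T) → y ∈₃ T → y ≢ x → y ∈₃ replace T x∈T v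
replace-⊇ _ 1st 1st y≢x = ⊥-elim (y≢x refl)
replace-⊇ _ 1st (inj₂ (inj₁ e)) _ = inj₁ e
replace-⊇ _ 1st (inj₂ (inj₂ e)) _ = inj₂ (inj₁ e)
replace-⊇ _ 2nd (inj₁ e) _ = inj₁ e
replace-⊇ _ 2nd 2nd y≢x = ⊥-elim (y≢x refl)
replace-⊇ _ 2nd (inj₂ (inj₂ e)) _ = inj₂ (inj₁ e)
replace-⊇ _ 3rd (inj₁ e) _ = inj₁ e
replace-⊇ _ 3rd (inj₂ (inj₁ e)) _ = inj₂ (inj₁ e)
replace-⊇ _ 3rd 3rd y≢x = ⊥-elim (y≢x refl)

replace-⊆ : ∀ {x y v} (T : Triple) → Distinct₃ T → (x∈T : x ∈₃ T) → y ∈₃ replace T x∈T v →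
            (y ∈₃ T × y ≢ x) ⊎ y ≡ v
replace-⊆ _ (a≢b , a≢c , b≢c) 1st 1st = inj₁ (2nd , λ e → a≢b (sym e))
replace-⊆ _ (a≢b , a≢c , b≢c) 1st 2nd = inj₁ (3rd , λ e → a≢c (sym e))
replace-⊆ _ (a≢b , a≢c , b≢c) 2nd 1st = inj₁ (1st , a≢b)
replace-⊆ _ (a≢b , a≢c , b≢c) 2nd 2nd = inj₁ (3rd , λ e → b≢c (sym e))
replace-⊆ _ (a≢b , a≢c , b≢c) 3rd 1st = inj₁ (1st , a≢c)
replace-⊆ _ (a≢b , a≢c , b≢c) 3rd 2nd = inj₁ (2nd , b≢c)
replace-⊆ _ _ _ (inj₂ (inj₂ e)) = inj₂ e

Increasing₃ : Triple → Set
Increasing₃ (a , b , c) = a < b × b < c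

increasing-≈₃⇒≡ : ∀ {T T′} → Increasing₃ T → Increasing₃ T′ → T ≈₃ T′ → T ≡ T′
increasing-≈₃⇒≡ {a , b , c} {a′ , b′ , c′} (a<b , b<c) (a′<b′ , b′<c′) (T⊆T′ , T′⊆T) =
  same a≡a′ b≡b′ (T⊆T′ 3rd)
  where
  least : ∀ {p q r x} → p < q → q < r → x ∈₃ (p , q , r) → p ≤ x
  least p<q q<r 1st = ≤-refl
  least p<q q<r 2nd = <⇒≤ p<q
  least p<q q<r 3rd = <⇒≤ (<-trans p<q q<r)
  second : ∀ {p q r x} → p < q → q < r → x ∈₃ (p , q , r) → x ≢ p → q ≤ x
  second p<q q<r 1st x≢p = ⊥-elim (x≢p refl)
  second p<q q<r 2nd x≢p = ≤-refl
  second p<q q<r 3rd x≢p = <⇒≤ q<r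
  a≡a′ : a ≡ a′
  a≡a′ = ≤-antisym (least a<b b<c (T′⊆T 1st)) (least a′<b′ b′<c′ (T⊆T′ 1st))
  b≡b′ : b ≡ b′
  b≡b′ = ≤-antisym (second a<b b<c (T′⊆T 2nd) λ b′≡a → <-irrefl (sym (trans b′≡a a≡a′)) a′<b′)
                   (second a′<b′ b′<c′ (T⊆T′ 2nd) λ b≡a′ → <-irrefl (trans a≡a′ (sym b≡a′)) a<b)
  same : a ≡ a′ → b ≡ b′ → c ∈₃ (a′ , b′ , c′) → (a , b , c) ≡ (a′ , b′ , c′)
  same refl refl 1st = ⊥-elim (<-irrefl refl (<-trans a<b b<c))
  same refl refl 2nd = ⊥-elim (<-irrefl refl b<c)
  same refl refl 3rd = refl

ShareEdge : Triple → Triple → Set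
ShareEdge T T′ = ∃₂ λ c d → ∃₂ λ u v → T ↭₃ (c , d , u) × T′ ↭₃ (c , d , v) × u ≢ v

ShareEdge-sym : ∀ {T T′} → ShareEdge T T′ → ShareEdge T′ T
ShareEdge-sym (c , d , u , v , π , π′ , u≢v) = c , d , v , u , π′ , π , u≢v ∘ sym

-- Complements of K₄-free graphs

-- G is the complement of the K₄-free graph A, which is given on the ℕ-labels of the vertices so that
-- its triangles can be handled as triples of numbers.
module ComplementOfK4Free {n : ℕ} (A : ℕ → ℕ → Set)
    (A? : ∀ a b → Dec (A a b))
    (A-sym : ∀ {a b} → A a b → A b a)
    (A-irrefl : ∀ {a} → ¬ A a a)
    (A-bounded : ∀ {a b} → A a b → a < suc n)
    (K4-free : ∀ {a b c d} → A a b → A a c → A b c → A d a → A d b → A d c → ⊥)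
  where

  G : Graph (suc n)
  G u v = u ≢ v × ¬ A (toℕ u) (toℕ v)

  IsTriangle : Triple → Set
  IsTriangle (a , b , c) = A a b × A a c × A b c

  private variable
    a b c d u v x y : ℕ
    T T′ : Triple
    X : Subset (suc n)

  ↭₃-triangle : T ↭₃ T′ → IsTriangle T → IsTriangle T′
  ↭₃-triangle abc t = t
  ↭₃-triangle acb (ab , ac , bc) = ac , ab , A-sym bc
  ↭₃-triangle bac (ab , ac , bc) = A-sym ab , bc , ac
  ↭₃-triangle bca (ab , ac , bc) = bc , A-sym ab , A-sym ac
  ↭₃-triangle cab (ab , ac , bc) = A-sym ac , A-sym bc , ab
  ↭₃-triangle cba (ab , ac , bc) = A-sym bc , A-sym ac , A-sym ab

  adjacent⇒≢ : A a b → a ≢ b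
  adjacent⇒≢ ab refl = A-irrefl ab

  triangle-distinct : IsTriangle T → Distinct₃ T
  triangle-distinct (ab , ac , bc) = adjacent⇒≢ ab , adjacent⇒≢ ac , adjacent⇒≢ bc

  triangle-adjacent : IsTriangle T → x ∈₃ T → y ∈₃ T → x ≢ y → A x y
  triangle-adjacent _ 1st 1st x≢y = ⊥-elim (x≢y refl)
  triangle-adjacent (ab , ac , bc) 1st 2nd _ = ab
  triangle-adjacent (ab , ac , bc) 1st 3rd _ = ac
  triangle-adjacent (ab , ac , bc) 2nd 1st _ = A-sym ab
  triangle-adjacent _ 2nd 2nd x≢y = ⊥-elim (x≢y refl)
  triangle-adjacent (ab , ac , bc) 2nd 3rd _ = bc
  triangle-adjacent (ab , ac , bc) 3rd 1st _ = A-sym ac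
  triangle-adjacent (ab , ac , bc) 3rd 2nd _ = A-sym bc
  triangle-adjacent _ 3rd 3rd x≢y = ⊥-elim (x≢y refl)

  triangle-bounded : IsTriangle T → x ∈₃ T → x < suc n
  triangle-bounded (ab , ac , bc) 1st = A-bounded ab
  triangle-bounded (ab , ac , bc) 2nd = A-bounded bc
  triangle-bounded (ab , ac , bc) 3rd = A-bounded (A-sym bc)

  triangle-maximal : IsTriangle T → (∀ {x} → x ∈₃ T → A d x) → ⊥
  triangle-maximal (ab , ac , bc) d-adj = K4-free ab ac bc (d-adj 1st) (d-adj 2nd) (d-adj 3rd)

  vertexAt : x < suc n → ∃ λ (u : Fin (suc n)) → toℕ u ≡ x
  vertexAt x<N = fromℕ< x<N , toℕ-fromℕ< x<N

  private
    indicator : Triple → Fin (suc n) → Bool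
    indicator T i = does (toℕ i ∈₃? T)

  ⟦_⟧ : Triple → Subset (suc n)
  ⟦ T ⟧ = tabulate (indicator T)

  ∈⟦⟧⁺ : ∀ {i} → toℕ i ∈₃ T → i ∈ ⟦ T ⟧
  ∈⟦⟧⁺ {T} {i} i∈T = lookup⇒[]= i _ (trans (lookup∘tabulate (indicator T) i) (dec-true (toℕ i ∈₃? T) i∈T))

  ∈⟦⟧⁻ : ∀ {i} → i ∈ ⟦ T ⟧ → toℕ i ∈₃ T
  ∈⟦⟧⁻ {T} {i} i∈ = decidable-stable (toℕ i ∈₃? T) λ i∉T →
    true≢false (trans (sym ([]=⇒lookup i∈)) (trans (lookup∘tabulate (indicator T) i) (dec-false (toℕ i ∈₃? T) i∉T)))
    where
    true≢false : true ≢ false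
    true≢false ()

  ⟦⟧-cong : T ≈₃ T′ → ⟦ T ⟧ ≡ ⟦ T′ ⟧
  ⟦⟧-cong (T⊆T′ , T′⊆T) = ⊆-antisym (∈⟦⟧⁺ ∘ T⊆T′ ∘ ∈⟦⟧⁻) (∈⟦⟧⁺ ∘ T′⊆T ∘ ∈⟦⟧⁻)

  ⟦⟧-injective : IsTriangle T → IsTriangle T′ → ⟦ T ⟧ ≡ ⟦ T′ ⟧ → T ≈₃ T′
  ⟦⟧-injective t t′ eq = transport t eq , transport t′ (sym eq)
    where
    transport : ∀ {T T′} → IsTriangle T → ⟦ T ⟧ ≡ ⟦ T′ ⟧ → ∀ {x} → x ∈₃ T → x ∈₃ T′
    transport t eq x∈T with vertexAt (triangle-bounded t x∈T)
    ... | i , refl = ∈⟦⟧⁻ (subst (i ∈_) eq (∈⟦⟧⁺ x∈T))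

  ∣⟦triangle⟧∣≡3 : IsTriangle T → ∣ ⟦ T ⟧ ∣ ≡ 3
  ∣⟦triangle⟧∣≡3 {T} t@(ab , ac , bc)
    with vertexAt (triangle-bounded t 1st) | vertexAt (triangle-bounded t 2nd) | vertexAt (triangle-bounded t 3rd)
  ... | a′ , refl | b′ , refl | c′ , refl =
    trans (cong ∣_∣ (⊆-antisym T⊆abc abc⊆T))
          (∣⁅x⁆∪⁅y⁆∪⁅z⁆∣≡3 (adjacent⇒≢ ab ∘ cong toℕ) (adjacent⇒≢ ac ∘ cong toℕ) (adjacent⇒≢ bc ∘ cong toℕ))
    where
    singleton : ∀ {i j : Fin (suc n)} → toℕ i ≡ toℕ j → i ∈ ⁅ j ⁆
    singleton {j = j} e = subst (_∈ ⁅ j ⁆) (sym (toℕ-injective e)) (x∈⁅x⁆ j)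
    T⊆abc : ⟦ T ⟧ ⊆ ⁅ a′ ⁆ ∪ ⁅ b′ ⁆ ∪ ⁅ c′ ⁆
    T⊆abc i∈ with ∈⟦⟧⁻ i∈
    ... | inj₁ e = x∈p∪q⁺ (inj₁ (singleton e))
    ... | inj₂ (inj₁ e) = x∈p∪q⁺ (inj₂ (x∈p∪q⁺ (inj₁ (singleton e))))
    ... | inj₂ (inj₂ e) = x∈p∪q⁺ (inj₂ (x∈p∪q⁺ (inj₂ (singleton e))))
    abc⊆T : ⁅ a′ ⁆ ∪ ⁅ b′ ⁆ ∪ ⁅ c′ ⁆ ⊆ ⟦ T ⟧
    abc⊆T i∈ with x∈p∪q⁻ ⁅ a′ ⁆ _ i∈
    ... | inj₁ i∈a = ∈⟦⟧⁺ {T} (inj₁ (cong toℕ (x∈⁅y⁆⇒x≡y a′ i∈a)))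
    ... | inj₂ i∈bc with x∈p∪q⁻ ⁅ b′ ⁆ ⁅ c′ ⁆ i∈bc
    ...   | inj₁ i∈b = ∈⟦⟧⁺ {T} (inj₂ (inj₁ (cong toℕ (x∈⁅y⁆⇒x≡y b′ i∈b))))
    ...   | inj₂ i∈c = ∈⟦⟧⁺ {T} (inj₂ (inj₂ (cong toℕ (x∈⁅y⁆⇒x≡y c′ i∈c))))

  G? : ∀ u v → Dec (G u v)
  G? u v = ¬? (u ≟ᶠ v) ×-dec ¬? (A? (toℕ u) (toℕ v))

  independent⇒adjacent : Independent G X → ∀ {u v} → u ∈ X → v ∈ X → u ≢ v → A (toℕ u) (toℕ v)
  independent⇒adjacent indep u∈ v∈ u≢v = decidable-stable (A? _ _) λ ¬A → indep _ _ u∈ v∈ (u≢v , ¬A)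

  triangle-independent : IsTriangle T → Independent G ⟦ T ⟧
  triangle-independent t u v u∈ v∈ (u≢v , ¬A) = ¬A (triangle-adjacent t (∈⟦⟧⁻ u∈) (∈⟦⟧⁻ v∈) (u≢v ∘ toℕ-injective))

  triangle-dominating : IsTriangle T → Dominating G ⟦ T ⟧
  triangle-dominating {T} t v with v ∈? ⟦ T ⟧
  ... | yes v∈ = inj₁ v∈
  ... | no v∉ with any? (λ u → u ∈? ⟦ T ⟧ ×-dec G? u v)
  ...   | yes (u , u∈ , Guv) = inj₂ (u , u∈ , Guv)
  ...   | no none = ⊥-elim (triangle-maximal t v-adjacent)
    where
    v-adjacent : ∀ {x} → x ∈₃ T → A (toℕ v) x
    v-adjacent x∈T with vertexAt (triangle-bounded t x∈T)
    ... | u , refl = A-sym (decidable-stable (A? _ _) λ ¬A →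
                       none (u , ∈⟦⟧⁺ x∈T , (λ { refl → v∉ (∈⟦⟧⁺ x∈T) }) , ¬A))

  module _ (hasNeighbour : ∀ (u : Fin (suc n)) → ∃ λ b → A (toℕ u) b)
           (edgeInTriangle : ∀ {a b} → A a b → ∃ λ T → IsTriangle T × a ∈₃ T × b ∈₃ T)
    where

    independent⇒inTriangle : Independent G X → ∃ λ T → IsTriangle T × X ⊆ ⟦ T ⟧
    independent⇒inTriangle {X} indep with any? (_∈? X)
    ... | no empty = let (T , t , _) = edgeInTriangle (proj₂ (hasNeighbour zero)) in
                     T , t , λ {x} x∈ → ⊥-elim (empty (x , x∈))
    ... | yes (u , u∈) with any? (λ v → v ∈? X ×-dec ¬? (v ≟ᶠ u))
    ...   | no onlyU = let (T , t , u∈T , _) = edgeInTriangle (proj₂ (hasNeighbour u)) in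
                       T , t , λ x∈ → subst (_∈ ⟦ T ⟧) (sym (≡u x∈)) (∈⟦⟧⁺ u∈T)
      where
      ≡u : ∀ {x} → x ∈ X → x ≡ u
      ≡u {x} x∈ = decidable-stable (x ≟ᶠ u) λ x≢u → onlyU (x , x∈ , x≢u)
    ...   | yes (v , v∈ , v≢u) with any? (λ w → w ∈? X ×-dec ¬? (w ≟ᶠ u) ×-dec ¬? (w ≟ᶠ v))
    ...     | no onlyUV = let (T , t , u∈T , v∈T) = edgeInTriangle (independent⇒adjacent indep u∈ v∈ (v≢u ∘ sym)) in
                          T , t , λ {x} x∈ → [ (λ x≡u → subst (_∈ ⟦ T ⟧) (sym x≡u) (∈⟦⟧⁺ u∈T)) ,
                                                (λ x≡v → subst (_∈ ⟦ T ⟧) (sym x≡v) (∈⟦⟧⁺ v∈T)) ]′ (≡u⊎≡v x∈)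
      where
      ≡u⊎≡v : ∀ {x} → x ∈ X → x ≡ u ⊎ x ≡ v
      ≡u⊎≡v {x} x∈ with x ≟ᶠ u | x ≟ᶠ v
      ... | yes x≡u | _ = inj₁ x≡u
      ... | no _ | yes x≡v = inj₂ x≡v
      ... | no x≢u | no x≢v = ⊥-elim (onlyUV (x , x∈ , x≢u , x≢v))
    ...     | yes (w , w∈ , w≢u , w≢v) = uvw , t , X⊆uvw
      where
      adj : ∀ {x y} → x ∈ X → y ∈ X → x ≢ y → A (toℕ x) (toℕ y)
      adj = independent⇒adjacent indep
      uvw = toℕ u , toℕ v , toℕ w
      t : IsTriangle uvw
      t = adj u∈ v∈ (v≢u ∘ sym) , adj u∈ w∈ (w≢u ∘ sym) , adj v∈ w∈ (w≢v ∘ sym)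
      X⊆uvw : X ⊆ ⟦ uvw ⟧
      X⊆uvw {x} x∈ with x ∈? ⟦ uvw ⟧
      ... | yes x∈T = x∈T
      ... | no x∉T = ⊥-elim (triangle-maximal t x-adjacent)
        where
        x-adjacent : ∀ {y} → y ∈₃ uvw → A (toℕ x) y
        x-adjacent 1st = adj x∈ u∈ (λ { refl → x∉T (∈⟦⟧⁺ {uvw} 1st) })
        x-adjacent 2nd = adj x∈ v∈ (λ { refl → x∉T (∈⟦⟧⁺ {uvw} 2nd) })
        x-adjacent 3rd = adj x∈ w∈ (λ { refl → x∉T (∈⟦⟧⁺ {uvw} 3rd) })

  replacement⇒slide : IsTriangle (c , d , u) → IsTriangle (c , d , v) → u ≢ v →
                     SlideAdj G ⟦ c , d , u ⟧ ⟦ c , d , v ⟧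
  replacement⇒slide {c} {d} tu@(cd , cu , du) tv@(_ , cv , dv) u≢v
    with vertexAt (triangle-bounded tu 3rd) | vertexAt (triangle-bounded tv 3rd)
  ... | u′ , refl | v′ , refl =
    u′ , v′ , ∈⟦⟧⁺ {old} 3rd , v′∉ , (u≢v ∘ cong toℕ , ¬Auv) , ⊆-antisym new⊆old old⊆new
    where
    old = c , d , toℕ u′
    new = c , d , toℕ v′
    v′∉ : v′ ∉ ⟦ old ⟧
    v′∉ v′∈ with ∈⟦⟧⁻ {old} v′∈
    ... | inj₁ v≡c = adjacent⇒≢ cv (sym v≡c)
    ... | inj₂ (inj₁ v≡d) = adjacent⇒≢ dv (sym v≡d)
    ... | inj₂ (inj₂ v≡u) = u≢v (sym v≡u)
    ¬Auv : ¬ A (toℕ u′) (toℕ v′)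
    ¬Auv uv = K4-free cd cu du (A-sym cv) (A-sym dv) (A-sym uv)
    kept : ∀ {i} → toℕ i ≡ c ⊎ toℕ i ≡ d → i ∈ ⟦ old ⟧ - u′
    kept (inj₁ i≡c) = x∈p∧x≢y⇒x∈p-y (∈⟦⟧⁺ {old} (inj₁ i≡c)) (λ { refl → adjacent⇒≢ cu (sym i≡c) })
    kept (inj₂ i≡d) = x∈p∧x≢y⇒x∈p-y (∈⟦⟧⁺ {old} (inj₂ (inj₁ i≡d))) (λ { refl → adjacent⇒≢ du (sym i≡d) })
    new⊆old : ⟦ new ⟧ ⊆ (⟦ old ⟧ - u′) ∪ ⁅ v′ ⁆
    new⊆old i∈ with ∈⟦⟧⁻ {new} i∈
    ... | inj₁ i≡c = x∈p∪q⁺ (inj₁ (kept (inj₁ i≡c)))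
    ... | inj₂ (inj₁ i≡d) = x∈p∪q⁺ (inj₁ (kept (inj₂ i≡d)))
    ... | inj₂ (inj₂ i≡v) = x∈p∪q⁺ (inj₂ (subst (_∈ ⁅ v′ ⁆) (sym (toℕ-injective i≡v)) (x∈⁅x⁆ v′)))
    old⊆new : (⟦ old ⟧ - u′) ∪ ⁅ v′ ⁆ ⊆ ⟦ new ⟧
    old⊆new {i} i∈ with x∈p∪q⁻ (⟦ old ⟧ - u′) ⁅ v′ ⁆ i∈
    ... | inj₂ i∈v = ∈⟦⟧⁺ {new} (inj₂ (inj₂ (cong toℕ (x∈⁅y⁆⇒x≡y v′ i∈v))))
    ... | inj₁ i∈old-u with ∈⟦⟧⁻ {old} (x∈p-y⇒x∈p i∈old-u)
    ...   | inj₁ i≡c = ∈⟦⟧⁺ {new} (inj₁ i≡c)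
    ...   | inj₂ (inj₁ i≡d) = ∈⟦⟧⁺ {new} (inj₂ (inj₁ i≡d))
    ...   | inj₂ (inj₂ i≡u) = ⊥-elim (x∈p-y⇒x≢y i∈old-u (toℕ-injective i≡u))

  shareEdge⇒slide : IsTriangle T → IsTriangle T′ → ShareEdge T T′ → SlideAdj G ⟦ T ⟧ ⟦ T′ ⟧
  shareEdge⇒slide t t′ (c , d , u , v , π , π′ , u≢v) =
    subst₂ (SlideAdj G) (sym (⟦⟧-cong (↭₃⇒≈₃ π))) (sym (⟦⟧-cong (↭₃⇒≈₃ π′)))
           (replacement⇒slide (↭₃-triangle π t) (↭₃-triangle π′ t′) u≢v)

  record Replacement (T T′ : Triple) : Set where
    field
      {old new}    : ℕ
      old∈T        : old ∈₃ T
      new≢old      : new ≢ old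
      new-adjacent : A (proj₁ (others T old∈T)) new × A (proj₂ (others T old∈T)) new
      T′≈          : T′ ≈₃ replace T old∈T new

  slide⇒replacement : IsTriangle T → IsTriangle T′ → SlideAdj G ⟦ T ⟧ ⟦ T′ ⟧ → Replacement T T′
  slide⇒replacement {T} {T′} t t′ (u , v , u∈ , v∉ , _ , T′≡) = record
    { old∈T = u∈T
    ; new≢old = λ v≡u → v∉T (subst (_∈₃ T) (sym v≡u) u∈T)
    ; new-adjacent = adjacent (proj₁ (others⊆ T u∈T)) (inj₁ refl) ,
                     adjacent (proj₂ (others⊆ T u∈T)) (inj₂ (inj₁ refl))
    ; T′≈ = T′⊆ , ⊆T′
    }
    where
    u∈T = ∈⟦⟧⁻ u∈
    v∉T : ¬ toℕ v ∈₃ T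
    v∉T = v∉ ∘ ∈⟦⟧⁺
    T′⊆ : ∀ {x} → x ∈₃ T′ → x ∈₃ replace T u∈T (toℕ v)
    T′⊆ x∈T′ with vertexAt (triangle-bounded t′ x∈T′)
    ... | i , refl with x∈p∪q⁻ (⟦ T ⟧ - u) ⁅ v ⁆ (subst (i ∈_) T′≡ (∈⟦⟧⁺ x∈T′))
    ...   | inj₂ i∈v = inj₂ (inj₂ (cong toℕ (x∈⁅y⁆⇒x≡y v i∈v)))
    ...   | inj₁ i∈T-u = replace-⊇ T u∈T (∈⟦⟧⁻ {T} (x∈p-y⇒x∈p i∈T-u)) (x∈p-y⇒x≢y i∈T-u ∘ toℕ-injective)
    ⊆T′ : ∀ {x} → x ∈₃ replace T u∈T (toℕ v) → x ∈₃ T′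
    ⊆T′ x∈ with replace-⊆ T (triangle-distinct t) u∈T x∈
    ... | inj₂ refl = ∈⟦⟧⁻ (subst (v ∈_) (sym T′≡) (x∈p∪q⁺ (inj₂ (x∈⁅x⁆ v))))
    ... | inj₁ (x∈T , x≢u) with vertexAt (triangle-bounded t x∈T)
    ...   | i , refl = ∈⟦⟧⁻ (subst (i ∈_) (sym T′≡) (x∈p∪q⁺ (inj₁ (x∈p∧x≢y⇒x∈p-y (∈⟦⟧⁺ x∈T) (x≢u ∘ cong toℕ)))))
    adjacent : ∀ {x} → x ∈₃ T → x ∈₃ replace T u∈T (toℕ v) → A x (toℕ v)
    adjacent x∈T x∈ = triangle-adjacent t′ (⊆T′ x∈) (⊆T′ (inj₂ (inj₂ refl))) λ { refl → v∉T x∈T }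

-- The graph Ḡ and its triangles

module WheelWithFan (m n : ℕ) where

  private variable
    a b c d i s t u v x : ℕ
    T : Triple

  k ℓ N : ℕ
  k = 3 + m
  ℓ = 3 + n
  N = k + ℓ

  last : ℕ
  last = k + ℓ ∸ 1

  k+2≤last : 2 + k ≤ last
  k+2≤last = s≤s (s≤s (subst (3 + m ≤_) (+-comm (3 + n) m) (+-monoʳ-≤ 3 (m≤n+m m n))))

  small≢last : t ≤ 4 → t ≢ last
  small≢last t≤4 = <⇒≢ (<-≤-trans (s≤s (≤-trans t≤4 (m≤m+n 4 m))) k+2≤last)

  k+1≢last : suc k ≢ last
  k+1≢last = <⇒≢ k+2≤last

  Edge : ℕ → ℕ → Set
  Edge = GbarEdge k ℓ

  Adj : ℕ → ℕ → Set
  Adj a b = Edge a b ⊎ Edge b a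

  Edge⇒< : Edge a b → a < b
  Edge⇒< (hub 1≤b _) = 1≤b
  Edge⇒< (rim _ _) = ≤-refl
  Edge⇒< rimEnd = s≤s (s≤s z≤n)
  Edge⇒< (path _ _) = ≤-refl
  Edge⇒< (toW2 k+2≤b _) = ≤-trans (s≤s (s≤s (s≤s z≤n))) k+2≤b
  Edge⇒< v1w1 = s≤s (s≤s z≤n)
  Edge⇒< vlastW3 = ≤-trans (s≤s (s≤s (s≤s (s≤s z≤n)))) k+2≤last

  Edge⇒≤last : Edge a b → b ≤ last
  Edge⇒≤last (hub _ b≤k+1) = ≤-trans b≤k+1 (≤-trans (n≤1+n _) k+2≤last)
  Edge⇒≤last (rim _ a≤k) = ≤-trans (s≤s a≤k) (≤-trans (n≤1+n _) k+2≤last)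
  Edge⇒≤last rimEnd = ≤-trans (n≤1+n _) k+2≤last
  Edge⇒≤last (path _ b≤last) = b≤last
  Edge⇒≤last (toW2 _ b≤last) = b≤last
  Edge⇒≤last v1w1 = k+2≤last
  Edge⇒≤last vlastW3 = ≤-refl

  Edge-irrefl : ¬ Edge a a
  Edge-irrefl e = <-irrefl refl (Edge⇒< e)

  Adj-sym : Adj a b → Adj b a
  Adj-sym (inj₁ e) = inj₂ e
  Adj-sym (inj₂ e) = inj₁ e

  Adj-irrefl : ¬ Adj a a
  Adj-irrefl (inj₁ e) = Edge-irrefl e
  Adj-irrefl (inj₂ e) = Edge-irrefl e

  Adj-bounded : Adj a b → a < N
  Adj-bounded (inj₁ e) = <-≤-trans (Edge⇒< e) (≤-trans (Edge⇒≤last e) (n≤1+n _))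
  Adj-bounded (inj₂ e) = s≤s (Edge⇒≤last e)

  Adj⇒Edge : a < b → Adj a b → Edge a b
  Adj⇒Edge a<b (inj₁ e) = e
  Adj⇒Edge a<b (inj₂ e) = ⊥-elim (<-asym a<b (Edge⇒< e))

  Adj⇒Edge′ : b < a → Adj a b → Edge b a
  Adj⇒Edge′ b<a ab = Adj⇒Edge b<a (Adj-sym ab)

  Adj⇒</> : Adj a b → a < b ⊎ b < a
  Adj⇒</> (inj₁ e) = inj₁ (Edge⇒< e)
  Adj⇒</> (inj₂ e) = inj₂ (Edge⇒< e)

  edge? : ∀ a b → Dec (Edge a b)
  edge? zero b with 1 ≤? b | b ≤? suc k
  ... | yes 1≤b | yes b≤k+1 = yes (hub 1≤b b≤k+1)
  ... | no 1≰b | _ = no λ { (hub 1≤b _) → 1≰b 1≤b ; (rim () _) ; (path () _) }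
  ... | yes _ | no b≰k+1 = no λ { (hub _ b≤k+1) → b≰k+1 b≤k+1 ; (rim () _) ; (path () _) }
  edge? 1 b with b ≟ 2 | b ≟ suc k | b ≟ 2 + k
  ... | yes refl | _ | _ = yes (rim (s≤s z≤n) (s≤s z≤n))
  ... | no _ | yes refl | _ = yes rimEnd
  ... | no _ | no _ | yes refl = yes v1w1
  ... | no b≢2 | no b≢k+1 | no b≢k+2 =
    no λ { (rim _ _) → b≢2 refl ; rimEnd → b≢k+1 refl ; v1w1 → b≢k+2 refl ; (path (s≤s ()) _) }
  edge? 2 b with b ≟ 3 | 2 + k ≤? b | b ≤? last
  ... | yes refl | _ | _ = yes (rim (s≤s z≤n) (s≤s (s≤s z≤n)))
  ... | no _ | yes k+2≤b | yes b≤last = yes (toW2 k+2≤b b≤last)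
  ... | no b≢3 | no k+2≰b | _ = no λ { (rim _ _) → b≢3 refl ; (toW2 k+2≤b _) → k+2≰b k+2≤b ; (path (s≤s (s≤s ())) _) }
  ... | no b≢3 | yes _ | no b≰last =
    no λ { (rim _ _) → b≢3 refl ; (toW2 _ b≤last) → b≰last b≤last ; (path (s≤s (s≤s ())) _) }
  edge? 3 b with b ≟ 4 | b ≟ last
  ... | yes refl | _ = yes (rim (s≤s z≤n) (s≤s (s≤s (s≤s z≤n))))
  ... | no _ | yes refl = yes vlastW3
  ... | no b≢4 | no b≢last = no λ { (rim _ _) → b≢4 refl ; vlastW3 → b≢last refl ; (path (s≤s (s≤s (s≤s ()))) _) }
  edge? a@(suc (suc (suc (suc _)))) b with b ≟ suc a
  ... | no b≢a+1 = no λ { (rim _ _) → b≢a+1 refl ; (path _ _) → b≢a+1 refl }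
  ... | yes refl with a ≤? k
  ...   | yes a≤k = yes (rim (s≤s z≤n) a≤k)
  ...   | no a≰k with 2 + k ≤? a | suc a ≤? last
  ...     | yes k+2≤a | yes a+1≤last = yes (path k+2≤a a+1≤last)
  ...     | no k+2≰a | _ = no λ { (rim _ a≤k) → a≰k a≤k ; (path k+2≤a _) → k+2≰a k+2≤a }
  ...     | yes _ | no a+1≰last = no λ { (rim _ a≤k) → a≰k a≤k ; (path _ a+1≤last) → a+1≰last a+1≤last }

  Adj? : ∀ a b → Dec (Adj a b)
  Adj? a b = edge? a b ⊎-dec edge? b a

  -- The triangles w₀wᵢwᵢ₊₁, w₀w₁wₖ₊₁, w₁w₂v₁, w₂vⱼvⱼ₊₁ and w₂w₃vₗ₋₂ of Ḡ, with increasing labels.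
  data Triangle : ℕ → ℕ → ℕ → Set where
    hubTriangle     : 1 ≤ i → i ≤ k → Triangle 0 i (suc i)
    closingTriangle : c ≡ suc k → Triangle 0 1 c
    firstFan        : c ≡ 2 + k → Triangle 1 2 c
    middleFan       : 2 + k ≤ b → suc b ≤ last → Triangle 2 b (suc b)
    lastFan         : c ≡ last → Triangle 2 3 c

  triangle-edges : Triangle a b c → Edge a b × Edge a c × Edge b c
  triangle-edges (hubTriangle 1≤i i≤k) = hub 1≤i (≤-trans i≤k (n≤1+n _)) , hub (s≤s z≤n) (s≤s i≤k) , rim 1≤i i≤k
  triangle-edges (closingTriangle refl) = hub (s≤s z≤n) (s≤s z≤n) , hub (s≤s z≤n) ≤-refl , rimEnd
  triangle-edges (firstFan refl) = rim (s≤s z≤n) (s≤s z≤n) , v1w1 , toW2 ≤-refl k+2≤last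
  triangle-edges (middleFan k+2≤b b+1≤last) =
    toW2 k+2≤b (≤-trans (n≤1+n _) b+1≤last) , toW2 (≤-trans k+2≤b (n≤1+n _)) b+1≤last , path k+2≤b b+1≤last
  triangle-edges (lastFan refl) = rim (s≤s z≤n) (s≤s (s≤s z≤n)) , toW2 k+2≤last ≤-refl , vlastW3

  private
    noEdgeAbove-k+1 : ¬ Edge (suc k) c
    noEdgeAbove-k+1 (rim _ k+1≤k) = 1+n≰n k+1≤k
    noEdgeAbove-k+1 (path k+2≤k+1 _) = 1+n≰n k+2≤k+1

    noEdge-2-[k+1] : ¬ Edge 2 (suc k)
    noEdge-2-[k+1] (toW2 k+2≤k+1 _) = 1+n≰n k+2≤k+1

    k+2≰4 : 2 + k ≤ b → b ≤ 4 → ⊥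
    k+2≰4 (s≤s (s≤s (s≤s (s≤s (s≤s _))))) (s≤s (s≤s (s≤s (s≤s ()))))

    noEdge-4-fan : 2 + k ≤ c → ¬ Edge 4 c
    noEdge-4-fan (s≤s (s≤s (s≤s (s≤s (s≤s z≤n))))) (rim _ (s≤s (s≤s (s≤s ()))))
    noEdge-4-fan _ (path (s≤s (s≤s (s≤s (s≤s ())))) _)

    fanEdge-upward : 2 + k ≤ b → Edge b c → c ≡ suc b × suc b ≤ last
    fanEdge-upward () (hub _ _)
    fanEdge-upward k+2≤b (rim _ b≤k) = ⊥-elim (1+n≰n (≤-trans k+2≤b (≤-trans b≤k (n≤1+n _))))
    fanEdge-upward (s≤s ()) rimEnd
    fanEdge-upward _ (path _ b+1≤last) = refl , b+1≤last
    fanEdge-upward (s≤s (s≤s ())) (toW2 _ _)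
    fanEdge-upward (s≤s ()) v1w1
    fanEdge-upward (s≤s (s≤s (s≤s ()))) vlastW3

    rimEdge⇒hubTriangle : 1 ≤ b → c ≤ suc k → Edge b c → Triangle 0 b c
    rimEdge⇒hubTriangle () _ (hub _ _)
    rimEdge⇒hubTriangle _ _ (rim 1≤b b≤k) = hubTriangle 1≤b b≤k
    rimEdge⇒hubTriangle _ _ rimEnd = closingTriangle refl
    rimEdge⇒hubTriangle _ c≤k+1 (path k+2≤b _) = ⊥-elim (<⇒≱ (≤-trans (n≤1+n _) k+2≤b) (≤-pred c≤k+1))
    rimEdge⇒hubTriangle _ c≤k+1 (toW2 k+2≤c _) = ⊥-elim (<⇒≱ k+2≤c c≤k+1)
    rimEdge⇒hubTriangle _ c≤k+1 v1w1 = ⊥-elim (1+n≰n c≤k+1)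
    rimEdge⇒hubTriangle _ c≤k+1 vlastW3 = ⊥-elim (1+n≰n (≤-trans k+2≤last c≤k+1))

  triangle : Edge a b → Edge a c → Edge b c → Triangle a b c
  triangle (hub 1≤b _) (hub _ c≤k+1) bc = rimEdge⇒hubTriangle 1≤b c≤k+1 bc
  triangle (rim () _) (hub _ _) _
  triangle (rim _ _) (rim _ _) bc = ⊥-elim (Edge-irrefl bc)
  triangle (rim _ _) rimEnd bc = ⊥-elim (noEdge-2-[k+1] bc)
  triangle (rim _ a≤k) (path k+2≤a _) _ = ⊥-elim (1+n≰n (≤-trans k+2≤a (≤-trans a≤k (n≤1+n _))))
  triangle (rim _ _) (toW2 k+2≤c _) (rim _ _) = ⊥-elim (k+2≰4 k+2≤c ≤-refl)
  triangle (rim _ _) (toW2 _ _) (path (s≤s (s≤s (s≤s ()))) _)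
  triangle (rim _ _) (toW2 _ _) vlastW3 = lastFan refl
  triangle (rim _ _) v1w1 (toW2 _ _) = firstFan refl
  triangle (rim _ _) vlastW3 bc = ⊥-elim (noEdge-4-fan k+2≤last bc)
  triangle rimEnd (rim _ _) bc = ⊥-elim (noEdgeAbove-k+1 bc)
  triangle rimEnd rimEnd bc = ⊥-elim (noEdgeAbove-k+1 bc)
  triangle rimEnd (path (s≤s ()) _) _
  triangle rimEnd v1w1 bc = ⊥-elim (noEdgeAbove-k+1 bc)
  triangle (path () _) (hub _ _) _
  triangle (path k+2≤a _) (rim _ a≤k) _ = ⊥-elim (1+n≰n (≤-trans k+2≤a (≤-trans a≤k (n≤1+n _))))
  triangle (path (s≤s ()) _) rimEnd _
  triangle (path _ _) (path _ _) bc = ⊥-elim (Edge-irrefl bc)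
  triangle (path (s≤s (s≤s ())) _) (toW2 _ _) _
  triangle (path (s≤s ()) _) v1w1 _
  triangle (path (s≤s (s≤s (s≤s ()))) _) vlastW3 _
  triangle (toW2 k+2≤b _) (rim _ _) bc = ⊥-elim (k+2≰4 k+2≤b (≤-trans (n≤1+n _) (≤-trans (Edge⇒< bc) (n≤1+n _))))
  triangle (toW2 _ _) (path (s≤s (s≤s ())) _) _
  triangle (toW2 k+2≤b _) (toW2 _ _) bc with fanEdge-upward k+2≤b bc
  ... | refl , b+1≤last = middleFan k+2≤b b+1≤last
  triangle v1w1 (rim _ _) bc = ⊥-elim (k+2≰4 ≤-refl (≤-trans (n≤1+n _) (≤-trans (Edge⇒< bc) (s≤s (s≤s z≤n)))))
  triangle v1w1 rimEnd bc = ⊥-elim (<⇒≱ (Edge⇒< bc) (n≤1+n _))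
  triangle v1w1 (path (s≤s ()) _) _
  triangle v1w1 v1w1 bc = ⊥-elim (Edge-irrefl bc)
  triangle vlastW3 (rim _ _) bc = ⊥-elim (k+2≰4 k+2≤last (≤-trans (n≤1+n _) (Edge⇒< bc)))
  triangle vlastW3 (path (s≤s (s≤s (s≤s ()))) _) _
  triangle vlastW3 vlastW3 bc = ⊥-elim (Edge-irrefl bc)

  noSortedK4 : Triangle a b c → Triangle a b d → ¬ Edge c d
  noSortedK4 (hubTriangle _ _) (hubTriangle _ _) cd = Edge-irrefl cd
  noSortedK4 (hubTriangle _ _) (closingTriangle refl) cd = noEdge-2-[k+1] cd
  noSortedK4 (closingTriangle refl) (hubTriangle _ _) cd = noEdgeAbove-k+1 cd
  noSortedK4 (closingTriangle refl) (closingTriangle refl) cd = Edge-irrefl cd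
  noSortedK4 (firstFan refl) (firstFan refl) cd = Edge-irrefl cd
  noSortedK4 (middleFan _ _) (middleFan _ _) cd = Edge-irrefl cd
  noSortedK4 (middleFan (s≤s (s≤s (s≤s ()))) _) (lastFan _) _
  noSortedK4 (lastFan _) (middleFan (s≤s (s≤s (s≤s ()))) _) _
  noSortedK4 (lastFan refl) (lastFan refl) cd = Edge-irrefl cd

  triangle-increasing : Triangle a b c → Increasing₃ (a , b , c)
  triangle-increasing t = let (ab , _ , bc) = triangle-edges t in Edge⇒< ab , Edge⇒< bc

  noK4 : Edge a b → Edge a c → Edge a d → Edge b c → Edge b d → ¬ Edge c d
  noK4 ab ac ad bc bd = noSortedK4 (triangle ab ac bc) (triangle ab ad bd)

  triangle-noCommonNeighbour : Triangle a b c → Adj d a → Adj d b → Adj d c → ⊥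
  triangle-noCommonNeighbour t da db dc with triangle-edges t | Adj⇒</> da | Adj⇒</> db | Adj⇒</> dc
  ... | ab , ac , bc | inj₁ d<a | _ | _ =
    noK4 (Adj⇒Edge d<a da) (Adj⇒Edge (<-trans d<a (Edge⇒< ab)) db) (Adj⇒Edge (<-trans d<a (Edge⇒< ac)) dc) ab ac bc
  ... | ab , ac , bc | inj₂ a<d | inj₁ d<b | _ =
    noK4 (Adj⇒Edge′ a<d da) ab ac (Adj⇒Edge d<b db) (Adj⇒Edge (<-trans d<b (Edge⇒< bc)) dc) bc
  ... | ab , ac , bc | inj₂ a<d | inj₂ b<d | inj₁ d<c =
    noK4 ab (Adj⇒Edge′ a<d da) ac (Adj⇒Edge′ b<d db) bc (Adj⇒Edge d<c dc)
  ... | ab , ac , bc | inj₂ a<d | inj₂ b<d | inj₂ c<d =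
    noK4 ab ac (Adj⇒Edge′ a<d da) bc (Adj⇒Edge′ b<d db) (Adj⇒Edge′ c<d dc)

  SortedTriangle : Triple → Set
  SortedTriangle (a , b , c) = Triangle a b c

  sortTriangle : Adj a b → Adj a c → Adj b c → ∃ λ T → SortedTriangle T × (a , b , c) ↭₃ T
  sortTriangle ab ac bc with Adj⇒</> ab | Adj⇒</> ac | Adj⇒</> bc
  ... | inj₁ a<b | inj₁ a<c | inj₁ b<c = _ , triangle (Adj⇒Edge a<b ab) (Adj⇒Edge a<c ac) (Adj⇒Edge b<c bc) , abc
  ... | inj₁ a<b | inj₁ a<c | inj₂ c<b = _ , triangle (Adj⇒Edge a<c ac) (Adj⇒Edge a<b ab) (Adj⇒Edge′ c<b bc) , acb
  ... | inj₁ a<b | inj₂ c<a | inj₁ b<c = ⊥-elim (<-asym (<-trans a<b b<c) c<a)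
  ... | inj₁ a<b | inj₂ c<a | inj₂ c<b = _ , triangle (Adj⇒Edge′ c<a ac) (Adj⇒Edge′ c<b bc) (Adj⇒Edge a<b ab) , cab
  ... | inj₂ b<a | inj₁ a<c | inj₁ b<c = _ , triangle (Adj⇒Edge′ b<a ab) (Adj⇒Edge b<c bc) (Adj⇒Edge a<c ac) , bac
  ... | inj₂ b<a | inj₁ a<c | inj₂ c<b = ⊥-elim (<-asym (<-trans b<a a<c) c<b)
  ... | inj₂ b<a | inj₂ c<a | inj₁ b<c = _ , triangle (Adj⇒Edge b<c bc) (Adj⇒Edge′ b<a ab) (Adj⇒Edge′ c<a ac) , bca
  ... | inj₂ b<a | inj₂ c<a | inj₂ c<b = _ , triangle (Adj⇒Edge′ c<b bc) (Adj⇒Edge′ c<a ac) (Adj⇒Edge′ b<a ab) , cba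

  Adj-K4-free : Adj a b → Adj a c → Adj b c → Adj d a → Adj d b → Adj d c → ⊥
  Adj-K4-free {d = d} ab ac bc da db dc with sortTriangle ab ac bc
  ... | T@(_ , _ , _) , t , π = triangle-noCommonNeighbour t (d-adj 1st) (d-adj 2nd) (d-adj 3rd)
    where
    d-adj : ∀ {x} → x ∈₃ T → Adj d x
    d-adj x∈T with ↭₃⇒⊆₃ (↭₃-sym π) x∈T
    ... | 1st = da
    ... | 2nd = db
    ... | 3rd = dc

  open ComplementOfK4Free Adj Adj? Adj-sym Adj-irrefl Adj-bounded Adj-K4-free public

  others-edge : ∀ {u} → SortedTriangle T → (u∈T : u ∈₃ T) → Edge (proj₁ (others T u∈T)) (proj₂ (others T u∈T))
  others-edge {_ , _ , _} t (inj₁ _) = proj₂ (proj₂ (triangle-edges t))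
  others-edge {_ , _ , _} t (inj₂ (inj₁ _)) = proj₁ (proj₂ (triangle-edges t))
  others-edge {_ , _ , _} t (inj₂ (inj₂ _)) = proj₁ (triangle-edges t)

  sorted⇒isTriangle : ∀ {T} → SortedTriangle T → IsTriangle T
  sorted⇒isTriangle {_ , _ , _} t = let (ab , ac , bc) = triangle-edges t in inj₁ ab , inj₁ ac , inj₁ bc

  -- Labelling the triangles by the vertices of θ_{1,k,ℓ}

  data Label : ℕ → Set where
    w₀w₁w₂    : Label 0
    w₀w₂w₃    : Label 1
    w₀w₁wₖ₊₁  : Label 2
    w₀wᵢwᵢ₊₁  : ∀ s r → s + r ≡ m → Label (3 + s)
    w₁w₂v₁    : t ≡ suc k → Label t
    w₂vⱼvⱼ₊₁  : 2 + k ≤ t → suc t ≤ last → Label t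
    w₂w₃vₗ₋₂  : t ≡ last → Label t

  triangleOf : Label t → Triple
  triangleOf w₀w₁w₂ = 0 , 1 , 2
  triangleOf w₀w₂w₃ = 0 , 2 , 3
  triangleOf w₀w₁wₖ₊₁ = 0 , 1 , suc k
  triangleOf (w₀wᵢwᵢ₊₁ s r _) = 0 , 3 + r , 4 + r
  triangleOf (w₁w₂v₁ _) = 1 , 2 , 2 + k
  triangleOf {t} (w₂vⱼvⱼ₊₁ _ _) = 2 , t , suc t
  triangleOf {t} (w₂w₃vₗ₋₂ _) = 2 , 3 , t

  triangleOf-sorted : (v : Label t) → SortedTriangle (triangleOf v)
  triangleOf-sorted w₀w₁w₂ = hubTriangle (s≤s z≤n) (s≤s z≤n)
  triangleOf-sorted w₀w₂w₃ = hubTriangle (s≤s z≤n) (s≤s (s≤s z≤n))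
  triangleOf-sorted w₀w₁wₖ₊₁ = closingTriangle refl
  triangleOf-sorted (w₀wᵢwᵢ₊₁ s r s+r≡m) = hubTriangle (s≤s z≤n) (+-monoʳ-≤ 3 (subst (r ≤_) s+r≡m (m≤n+m r s)))
  triangleOf-sorted (w₁w₂v₁ _) = firstFan refl
  triangleOf-sorted (w₂vⱼvⱼ₊₁ k+2≤t t+1≤last) = middleFan k+2≤t t+1≤last
  triangleOf-sorted (w₂w₃vₗ₋₂ t≡last) = lastFan t≡last

  labelOf : Triple → ℕ
  labelOf (0 , 1 , 2) = 0
  labelOf (0 , 1 , _) = 2
  labelOf (0 , 2 , _) = 1
  labelOf (0 , suc (suc (suc q)) , _) = 3 + (m ∸ q)
  labelOf (1 , _ , _) = suc k
  labelOf (2 , 3 , _) = last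
  labelOf (2 , q , _) = q
  labelOf _ = 0

  labelOf-triangleOf : (v : Label t) → labelOf (triangleOf v) ≡ t
  labelOf-triangleOf w₀w₁w₂ = refl
  labelOf-triangleOf w₀w₂w₃ = refl
  labelOf-triangleOf w₀w₁wₖ₊₁ = refl
  labelOf-triangleOf (w₀wᵢwᵢ₊₁ s r refl) = cong (3 +_) (m+n∸n≡m s r)
  labelOf-triangleOf (w₁w₂v₁ t≡k+1) = sym t≡k+1
  labelOf-triangleOf (w₂vⱼvⱼ₊₁ (s≤s (s≤s (s≤s (s≤s (s≤s _))))) _) = refl
  labelOf-triangleOf (w₂w₃vₗ₋₂ t≡last) = sym t≡last

  triangleOf-injective : ∀ {t′} (v : Label t) (v′ : Label t′) → triangleOf v ≡ triangleOf v′ → t ≡ t′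
  triangleOf-injective v v′ eq = trans (sym (labelOf-triangleOf v)) (trans (cong labelOf eq) (labelOf-triangleOf v′))

  private
    wheelLabel≤k : ∀ {r} → s + r ≡ m → 3 + s ≤ k
    wheelLabel≤k {s} {r} s+r≡m = +-monoʳ-≤ 3 (subst (s ≤_) s+r≡m (m≤m+n s r))

    wheelLabel≱k+1 : ∀ {r} → s + r ≡ m → ¬ suc k ≤ 3 + s
    wheelLabel≱k+1 s+r≡m k+1≤ = 1+n≰n (≤-trans k+1≤ (wheelLabel≤k s+r≡m))

  triangleOf-unique : (v v′ : Label t) → triangleOf v ≡ triangleOf v′
  triangleOf-unique w₀w₁w₂ w₀w₁w₂ = refl
  triangleOf-unique w₀w₂w₃ w₀w₂w₃ = refl
  triangleOf-unique w₀w₁wₖ₊₁ w₀w₁wₖ₊₁ = refl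
  triangleOf-unique (w₀wᵢwᵢ₊₁ s r e) (w₀wᵢwᵢ₊₁ .s r′ e′) =
    cong (λ q → 0 , 3 + q , 4 + q) (+-cancelˡ-≡ s r r′ (trans e (sym e′)))
  triangleOf-unique (w₁w₂v₁ _) (w₁w₂v₁ _) = refl
  triangleOf-unique (w₂vⱼvⱼ₊₁ _ _) (w₂vⱼvⱼ₊₁ _ _) = refl
  triangleOf-unique (w₂w₃vₗ₋₂ _) (w₂w₃vₗ₋₂ _) = refl
  triangleOf-unique w₀w₁w₂ (w₁w₂v₁ ())
  triangleOf-unique w₀w₁w₂ (w₂vⱼvⱼ₊₁ () _)
  triangleOf-unique w₀w₁w₂ (w₂w₃vₗ₋₂ e) = ⊥-elim (small≢last z≤n e)
  triangleOf-unique w₀w₂w₃ (w₁w₂v₁ ())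
  triangleOf-unique w₀w₂w₃ (w₂vⱼvⱼ₊₁ (s≤s ()) _)
  triangleOf-unique w₀w₂w₃ (w₂w₃vₗ₋₂ e) = ⊥-elim (small≢last (s≤s z≤n) e)
  triangleOf-unique w₀w₁wₖ₊₁ (w₁w₂v₁ ())
  triangleOf-unique w₀w₁wₖ₊₁ (w₂vⱼvⱼ₊₁ (s≤s (s≤s ())) _)
  triangleOf-unique w₀w₁wₖ₊₁ (w₂w₃vₗ₋₂ e) = ⊥-elim (small≢last (s≤s (s≤s z≤n)) e)
  triangleOf-unique (w₀wᵢwᵢ₊₁ _ _ e) (w₁w₂v₁ refl) = ⊥-elim (wheelLabel≱k+1 e ≤-refl)
  triangleOf-unique (w₀wᵢwᵢ₊₁ _ _ e) (w₂vⱼvⱼ₊₁ k+2≤t _) = ⊥-elim (wheelLabel≱k+1 e (<⇒≤ k+2≤t))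
  triangleOf-unique (w₀wᵢwᵢ₊₁ _ _ e) (w₂w₃vₗ₋₂ t≡last) =
    ⊥-elim (wheelLabel≱k+1 e (≤-trans (n≤1+n _) (subst (2 + k ≤_) (sym t≡last) k+2≤last)))
  triangleOf-unique (w₁w₂v₁ refl) (w₂vⱼvⱼ₊₁ k+2≤k+1 _) = ⊥-elim (1+n≰n k+2≤k+1)
  triangleOf-unique (w₁w₂v₁ refl) (w₂w₃vₗ₋₂ e) = ⊥-elim (k+1≢last e)
  triangleOf-unique (w₂vⱼvⱼ₊₁ _ t+1≤last) (w₂w₃vₗ₋₂ refl) = ⊥-elim (1+n≰n t+1≤last)
  triangleOf-unique (w₁w₂v₁ ()) w₀w₁w₂
  triangleOf-unique (w₂vⱼvⱼ₊₁ () _) w₀w₁w₂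
  triangleOf-unique (w₂w₃vₗ₋₂ e) w₀w₁w₂ = ⊥-elim (small≢last z≤n e)
  triangleOf-unique (w₁w₂v₁ ()) w₀w₂w₃
  triangleOf-unique (w₂vⱼvⱼ₊₁ (s≤s ()) _) w₀w₂w₃
  triangleOf-unique (w₂w₃vₗ₋₂ e) w₀w₂w₃ = ⊥-elim (small≢last (s≤s z≤n) e)
  triangleOf-unique (w₁w₂v₁ ()) w₀w₁wₖ₊₁
  triangleOf-unique (w₂vⱼvⱼ₊₁ (s≤s (s≤s ())) _) w₀w₁wₖ₊₁
  triangleOf-unique (w₂w₃vₗ₋₂ e) w₀w₁wₖ₊₁ = ⊥-elim (small≢last (s≤s (s≤s z≤n)) e)
  triangleOf-unique (w₁w₂v₁ refl) (w₀wᵢwᵢ₊₁ _ _ e) = ⊥-elim (wheelLabel≱k+1 e ≤-refl)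
  triangleOf-unique (w₂vⱼvⱼ₊₁ k+2≤t _) (w₀wᵢwᵢ₊₁ _ _ e) = ⊥-elim (wheelLabel≱k+1 e (<⇒≤ k+2≤t))
  triangleOf-unique (w₂w₃vₗ₋₂ t≡last) (w₀wᵢwᵢ₊₁ _ _ e) =
    ⊥-elim (wheelLabel≱k+1 e (≤-trans (n≤1+n _) (subst (2 + k ≤_) (sym t≡last) k+2≤last)))
  triangleOf-unique (w₂vⱼvⱼ₊₁ k+2≤k+1 _) (w₁w₂v₁ refl) = ⊥-elim (1+n≰n k+2≤k+1)
  triangleOf-unique (w₂w₃vₗ₋₂ e) (w₁w₂v₁ refl) = ⊥-elim (k+1≢last e)
  triangleOf-unique (w₂w₃vₗ₋₂ refl) (w₂vⱼvⱼ₊₁ _ t+1≤last) = ⊥-elim (1+n≰n t+1≤last)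

  k+2<N : 2 + k < N
  k+2<N = s≤s k+2≤last

  k+1<N : suc k < N
  k+1<N = <-trans (n<1+n _) k+2<N

  Label⇒<N : Label t → t < N
  Label⇒<N w₀w₁w₂ = s≤s z≤n
  Label⇒<N w₀w₂w₃ = s≤s (s≤s z≤n)
  Label⇒<N w₀w₁wₖ₊₁ = s≤s (s≤s (s≤s z≤n))
  Label⇒<N (w₀wᵢwᵢ₊₁ s r s+r≡m) = ≤-trans (+-monoʳ-≤ 4 (subst (s ≤_) s+r≡m (m≤m+n s r))) (<⇒≤ k+1<N)
  Label⇒<N (w₁w₂v₁ refl) = k+1<N
  Label⇒<N (w₂vⱼvⱼ₊₁ _ t+1≤last) = ≤-trans t+1≤last (n≤1+n _)
  Label⇒<N (w₂w₃vₗ₋₂ refl) = ≤-refl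

  private
    fanLabel : k < t → t < N → Label t
    fanLabel {t} k<t t<N with t ≟ suc k | suc t ≤? last
    ... | yes t≡k+1 | _ = w₁w₂v₁ t≡k+1
    ... | no t≢k+1 | yes t+1≤last = w₂vⱼvⱼ₊₁ (≤∧≢⇒< k<t (t≢k+1 ∘ sym)) t+1≤last
    ... | no _ | no t+1≰last = w₂w₃vₗ₋₂ (≤-antisym (≤-pred t<N) (≮⇒≥ t+1≰last))

  label : ∀ t → t < N → Label t
  label 0 _ = w₀w₁w₂
  label 1 _ = w₀w₂w₃
  label 2 _ = w₀w₁wₖ₊₁
  label (suc (suc (suc s))) t<N with s ≤? m
  ... | yes s≤m = w₀wᵢwᵢ₊₁ s (m ∸ s) (m+[n∸m]≡n s≤m)
  ... | no s≰m = fanLabel (+-monoʳ-< 3 (≰⇒> s≰m)) t<N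

  sorted⇒label : ∀ {T} → SortedTriangle T → ∃ λ t → Σ (Label t) λ v → triangleOf v ≡ T
  sorted⇒label {_ , _ , _} (hubTriangle {1} _ _) = 0 , w₀w₁w₂ , refl
  sorted⇒label {_ , _ , _} (hubTriangle {2} _ _) = 1 , w₀w₂w₃ , refl
  sorted⇒label {_ , _ , _} (hubTriangle {suc (suc (suc r))} _ i≤k) =
    _ , w₀wᵢwᵢ₊₁ (m ∸ r) r (m∸n+n≡m (+-cancelˡ-≤ 3 r m i≤k)) , refl
  sorted⇒label {_ , _ , _} (closingTriangle refl) = 2 , w₀w₁wₖ₊₁ , refl
  sorted⇒label {_ , _ , _} (firstFan refl) = suc k , w₁w₂v₁ refl , refl
  sorted⇒label {_ , _ , _} (middleFan k+2≤b b+1≤last) = _ , w₂vⱼvⱼ₊₁ k+2≤b b+1≤last , refl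
  sorted⇒label {_ , _ , _} (lastFan refl) = last , w₂w₃vₗ₋₂ refl , refl

  triangleAt : Fin N → Triple
  triangleAt i = triangleOf (label (toℕ i) (toℕ<n i))

  triangleAt-sorted : ∀ i → SortedTriangle (triangleAt i)
  triangleAt-sorted i = triangleOf-sorted (label (toℕ i) (toℕ<n i))

  triangleAt-isTriangle : ∀ i → IsTriangle (triangleAt i)
  triangleAt-isTriangle i = sorted⇒isTriangle (triangleAt-sorted i)

  triangleAt-label : ∀ {i} → (v : Label t) → toℕ i ≡ t → triangleAt i ≡ triangleOf v
  triangleAt-label {i = i} v refl = triangleOf-unique (label (toℕ i) (toℕ<n i)) v

  sorted⇒triangleAt : SortedTriangle T → ∃ λ i → triangleAt i ≡ T
  sorted⇒triangleAt t with sorted⇒label t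
  ... | _ , v , refl = fromℕ< (Label⇒<N v) , triangleAt-label v (toℕ-fromℕ< (Label⇒<N v))

  triangleAt-injective : ∀ {i j} → triangleAt i ≡ triangleAt j → i ≡ j
  triangleAt-injective {i} {j} eq =
    toℕ-injective (triangleOf-injective (label (toℕ i) (toℕ<n i)) (label (toℕ j) (toℕ<n j)) eq)

  hasNeighbour : ∀ (i : Fin N) → ∃ λ b → Adj (toℕ i) b
  hasNeighbour i with toℕ i | toℕ<n i
  ... | zero | _ = 1 , inj₁ (hub (s≤s z≤n) (s≤s z≤n))
  ... | suc a | a<last with suc a ≤? suc k
  ...   | yes a+1≤k+1 = 0 , inj₂ (hub (s≤s z≤n) a+1≤k+1)
  ...   | no a+1≰k+1 = 2 , inj₂ (toW2 (≰⇒> a+1≰k+1) (≤-pred a<last))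

  edgeInSortedTriangle : Edge a b → ∃ λ T → SortedTriangle T × a ∈₃ T × b ∈₃ T
  edgeInSortedTriangle (hub {b} 1≤b b≤k+1) with b ≤? k
  ... | yes b≤k = (0 , b , suc b) , hubTriangle 1≤b b≤k , 1st , 2nd
  ... | no b≰k = (0 , 1 , suc k) , closingTriangle refl , 1st , inj₂ (inj₂ (≤-antisym b≤k+1 (≰⇒> b≰k)))
  edgeInSortedTriangle (rim 1≤a a≤k) = (0 , _ , _) , hubTriangle 1≤a a≤k , 2nd , 3rd
  edgeInSortedTriangle rimEnd = (0 , 1 , suc k) , closingTriangle refl , 2nd , 3rd
  edgeInSortedTriangle (path k+2≤a a+1≤last) = (2 , _ , _) , middleFan k+2≤a a+1≤last , 2nd , 3rd
  edgeInSortedTriangle (toW2 {b} k+2≤b b≤last) with suc b ≤? last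
  ... | yes b+1≤last = (2 , b , suc b) , middleFan k+2≤b b+1≤last , 1st , 2nd
  ... | no b+1≰last = (2 , 3 , b) , lastFan (≤-antisym b≤last (≮⇒≥ b+1≰last)) , 1st , 3rd
  edgeInSortedTriangle v1w1 = (1 , 2 , 2 + k) , firstFan refl , 1st , 3rd
  edgeInSortedTriangle vlastW3 = (2 , 3 , last) , lastFan refl , 2nd , 3rd

  edgeInTriangle : Adj a b → ∃ λ T → IsTriangle T × a ∈₃ T × b ∈₃ T
  edgeInTriangle (inj₁ e) = let (T , t , a∈ , b∈) = edgeInSortedTriangle e in T , sorted⇒isTriangle t , a∈ , b∈
  edgeInTriangle (inj₂ e) = let (T , t , b∈ , a∈) = edgeInSortedTriangle e in T , sorted⇒isTriangle t , a∈ , b∈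

  family : Fin N → Subset N
  family i = ⟦ triangleAt i ⟧

  family-indepDominating : ∀ i → IndepDominating G (family i)
  family-indepDominating i = let t = triangleAt-isTriangle i in triangle-independent t , triangle-dominating t

  ∣family∣≡3 : ∀ i → ∣ family i ∣ ≡ 3
  ∣family∣≡3 i = ∣⟦triangle⟧∣≡3 (triangleAt-isTriangle i)

  family-covers : ∀ {X} → Independent G X → ∃ λ i → X ⊆ family i
  family-covers {X} indep with independent⇒inTriangle hasNeighbour edgeInTriangle indep
  ... | (_ , _ , _) , (ab , ac , bc) , X⊆T with sortTriangle ab ac bc
  ...   | _ , t , π with sorted⇒triangleAt t
  ...     | i , refl = i , subst (X ⊆_) (⟦⟧-cong (↭₃⇒≈₃ π)) X⊆T

  family-injective : ∀ {i j} → family i ≡ family j → i ≡ j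
  family-injective {i} {j} eq =
    triangleAt-injective (increasing-≈₃⇒≡ (triangle-increasing (triangleAt-sorted i))
                                          (triangle-increasing (triangleAt-sorted j))
                                          (⟦⟧-injective (triangleAt-isTriangle i) (triangleAt-isTriangle j) eq))

  -- Slides and edges of θ_{1,k,ℓ}

  θ : ℕ → ℕ → Set
  θ = ThetaEdge k ℓ

  data Completion (c d : ℕ) : ℕ → Set where
    below   : Triangle v c d → Completion c d v
    between : Triangle c v d → Completion c d v
    above   : Triangle c d v → Completion c d v

  completion : Edge c d → Adj c v → Adj d v → Completion c d v
  completion cd cv dv with Adj⇒</> cv
  ... | inj₂ v<c = below (triangle (Adj⇒Edge′ v<c cv) (Adj⇒Edge′ (<-trans v<c (Edge⇒< cd)) dv) cd)
  ... | inj₁ c<v with Adj⇒</> dv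
  ...   | inj₂ v<d = between (triangle (Adj⇒Edge c<v cv) cd (Adj⇒Edge′ v<d dv))
  ...   | inj₁ d<v = above (triangle cd (Adj⇒Edge c<v cv) (Adj⇒Edge d<v dv))

  ThetaNeighbour : ℕ → Triple → Set
  ThetaNeighbour x T = ∃ λ y → Σ (Label y) λ w → T ↭₃ triangleOf w × (θ x y ⊎ θ y x)

  -- Every triangle sharing an edge with the triangle of x is the triangle of a θ-neighbour of x.
  NeighbourClosed : Label x → Set
  NeighbourClosed {x} vx = ∀ {u v} (u∈ : u ∈₃ triangleOf vx) → v ≢ u →
    Completion (proj₁ (others _ u∈)) (proj₂ (others _ u∈)) v → ThetaNeighbour x (replace _ u∈ v)

  neighbourClosed-w₀w₁w₂ : NeighbourClosed w₀w₁w₂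
  neighbourClosed-w₀w₁w₂ 1st v≢0 (below (hubTriangle _ _)) = ⊥-elim (v≢0 refl)
  neighbourClosed-w₀w₁w₂ 1st _ (below (middleFan (s≤s ()) _))
  neighbourClosed-w₀w₁w₂ 1st _ (between (firstFan ()))
  neighbourClosed-w₀w₁w₂ 1st _ (above (firstFan refl)) = suc k , w₁w₂v₁ refl , abc , inj₁ lStart
  neighbourClosed-w₀w₁w₂ 2nd v≢1 (between (hubTriangle _ _)) = ⊥-elim (v≢1 refl)
  neighbourClosed-w₀w₁w₂ 2nd _ (between (closingTriangle ()))
  neighbourClosed-w₀w₁w₂ 2nd _ (above (hubTriangle _ _)) = 1 , w₀w₂w₃ , abc , inj₁ direct
  neighbourClosed-w₀w₁w₂ 3rd _ (below (hubTriangle () _))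
  neighbourClosed-w₀w₁w₂ 3rd _ (between (hubTriangle () _))
  neighbourClosed-w₀w₁w₂ 3rd _ (between (closingTriangle ()))
  neighbourClosed-w₀w₁w₂ 3rd v≢2 (above (hubTriangle _ _)) = ⊥-elim (v≢2 refl)
  neighbourClosed-w₀w₁w₂ 3rd _ (above (closingTriangle refl)) = 2 , w₀w₁wₖ₊₁ , abc , inj₁ kStart

  neighbourClosed-w₀w₂w₃ : NeighbourClosed w₀w₂w₃
  neighbourClosed-w₀w₂w₃ 1st v≢0 (below (hubTriangle _ _)) = ⊥-elim (v≢0 refl)
  neighbourClosed-w₀w₂w₃ 1st _ (below (firstFan ()))
  neighbourClosed-w₀w₂w₃ 1st _ (below (middleFan (s≤s (s≤s ())) _))
  neighbourClosed-w₀w₂w₃ 1st _ (between (middleFan (s≤s (s≤s ())) _))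
  neighbourClosed-w₀w₂w₃ 1st _ (between (lastFan 3≡last)) = ⊥-elim (small≢last (s≤s (s≤s (s≤s z≤n))) 3≡last)
  neighbourClosed-w₀w₂w₃ 1st _ (above (middleFan (s≤s (s≤s (s≤s ()))) _))
  neighbourClosed-w₀w₂w₃ 1st _ (above (lastFan v≡last)) =
    _ , w₂w₃vₗ₋₂ v≡last , abc , inj₂ (subst (λ z → θ z 1) (sym v≡last) lEnd)
  neighbourClosed-w₀w₂w₃ 2nd v≢2 (between (hubTriangle _ _)) = ⊥-elim (v≢2 refl)
  neighbourClosed-w₀w₂w₃ 2nd _ (between (closingTriangle ()))
  neighbourClosed-w₀w₂w₃ 2nd _ (above (hubTriangle _ _)) = k , w₀wᵢwᵢ₊₁ m 0 (+-identityʳ m) , abc , inj₂ kEnd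
  neighbourClosed-w₀w₂w₃ 3rd _ (between (hubTriangle _ _)) = 0 , w₀w₁w₂ , acb , inj₂ direct
  neighbourClosed-w₀w₂w₃ 3rd _ (between (closingTriangle ()))
  neighbourClosed-w₀w₂w₃ 3rd v≢3 (above (hubTriangle _ _)) = ⊥-elim (v≢3 refl)

  neighbourClosed-w₀w₁wₖ₊₁ : NeighbourClosed w₀w₁wₖ₊₁
  neighbourClosed-w₀w₁wₖ₊₁ 1st v≢0 (below (closingTriangle _)) = ⊥-elim (v≢0 refl)
  neighbourClosed-w₀w₁wₖ₊₁ 1st _ (between (firstFan ()))
  neighbourClosed-w₀w₁wₖ₊₁ 2nd _ (between (hubTriangle _ _)) =
    3 , w₀wᵢwᵢ₊₁ 0 m refl , acb , inj₁ (kStep (s≤s (s≤s z≤n)) (s≤s (s≤s (s≤s z≤n))))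
  neighbourClosed-w₀w₁wₖ₊₁ 2nd v≢1 (between (closingTriangle _)) = ⊥-elim (v≢1 refl)
  neighbourClosed-w₀w₁wₖ₊₁ 2nd _ (above (hubTriangle _ k+1≤k)) = ⊥-elim (1+n≰n k+1≤k)
  neighbourClosed-w₀w₁wₖ₊₁ 3rd _ (below (hubTriangle () _))
  neighbourClosed-w₀w₁wₖ₊₁ 3rd _ (between (hubTriangle () _))
  neighbourClosed-w₀w₁wₖ₊₁ 3rd _ (between (closingTriangle ()))
  neighbourClosed-w₀w₁wₖ₊₁ 3rd _ (above (hubTriangle _ _)) = 0 , w₀w₁w₂ , abc , inj₂ kStart
  neighbourClosed-w₀w₁wₖ₊₁ 3rd v≢k+1 (above (closingTriangle refl)) = ⊥-elim (v≢k+1 refl)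

  neighbourClosed-w₀wᵢwᵢ₊₁ : ∀ s r (s+r≡m : s + r ≡ m) → NeighbourClosed (w₀wᵢwᵢ₊₁ s r s+r≡m)
  neighbourClosed-w₀wᵢwᵢ₊₁ _ _ _ 1st v≢0 (below (hubTriangle _ _)) = ⊥-elim (v≢0 refl)
  neighbourClosed-w₀wᵢwᵢ₊₁ s r s+r≡m 1st _ (below (middleFan (s≤s (s≤s (s≤s m+2≤r))) _)) =
    ⊥-elim (<⇒≱ (≤-trans (n≤1+n _) m+2≤r) (subst (r ≤_) s+r≡m (m≤n+m r s)))
  neighbourClosed-w₀wᵢwᵢ₊₁ _ _ _ 1st _ (below (lastFan 4≡last)) = ⊥-elim (small≢last ≤-refl 4≡last)
  neighbourClosed-w₀wᵢwᵢ₊₁ _ _ _ 2nd v≢3+r (between (hubTriangle _ _)) = ⊥-elim (v≢3+r refl)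
  neighbourClosed-w₀wᵢwᵢ₊₁ s r s+r≡m 2nd _ (between (closingTriangle 4+r≡k+1))
    with +-cancelˡ-≡ 4 r m 4+r≡k+1
  ... | refl with +-cancelʳ-≡ m s 0 s+r≡m
  ...   | refl = 2 , w₀w₁wₖ₊₁ , acb , inj₂ (kStep (s≤s (s≤s z≤n)) (s≤s (s≤s (s≤s z≤n))))
  neighbourClosed-w₀wᵢwᵢ₊₁ zero _ refl 2nd _ (above (hubTriangle _ m+4≤m+3)) = ⊥-elim (1+n≰n m+4≤m+3)
  neighbourClosed-w₀wᵢwᵢ₊₁ (suc s) r s+r≡m 2nd _ (above (hubTriangle _ _)) =
    3 + s , w₀wᵢwᵢ₊₁ s (suc r) (trans (+-suc s r) s+r≡m) , abc ,
    inj₂ (kStep (s≤s (s≤s z≤n)) (+-monoʳ-≤ 3 (subst (suc s ≤_) s+r≡m (m≤m+n (suc s) r))))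
  neighbourClosed-w₀wᵢwᵢ₊₁ s zero s+0≡m 3rd _ (between (hubTriangle _ _))
    with refl ← trans (sym (+-identityʳ s)) s+0≡m = 1 , w₀w₂w₃ , acb , inj₁ kEnd
  neighbourClosed-w₀wᵢwᵢ₊₁ s (suc r) s+r≡m 3rd _ (between (hubTriangle _ _)) =
    4 + s , w₀wᵢwᵢ₊₁ (suc s) r s+1+r≡m , acb ,
    inj₁ (kStep (s≤s (s≤s z≤n)) (+-monoʳ-≤ 3 (subst (suc s ≤_) s+1+r≡m (m≤m+n (suc s) r))))
    where
    s+1+r≡m = trans (sym (+-suc s r)) s+r≡m
  neighbourClosed-w₀wᵢwᵢ₊₁ s r s+r≡m 3rd _ (between (closingTriangle 3+r≡k+1))
    with refl ← +-cancelˡ-≡ 3 r (suc m) 3+r≡k+1 = ⊥-elim (1+n≰n (subst (suc m ≤_) s+r≡m (m≤n+m (suc m) s)))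
  neighbourClosed-w₀wᵢwᵢ₊₁ _ _ _ 3rd v≢4+r (above (hubTriangle _ _)) = ⊥-elim (v≢4+r refl)

  neighbourClosed-w₁w₂v₁ : (t≡k+1 : t ≡ suc k) → NeighbourClosed (w₁w₂v₁ t≡k+1)
  neighbourClosed-w₁w₂v₁ refl 1st v≢1 (below (firstFan _)) = ⊥-elim (v≢1 refl)
  neighbourClosed-w₁w₂v₁ refl 1st _ (between (middleFan k+2≤k+1 _)) = ⊥-elim (1+n≰n k+2≤k+1)
  neighbourClosed-w₁w₂v₁ refl 1st _ (between (lastFan k+2≡last)) =
    2 + k , w₂w₃vₗ₋₂ k+2≡last , acb , inj₁ (lStep ≤-refl k+2≤last)
  neighbourClosed-w₁w₂v₁ refl 1st _ (above (middleFan _ k+3≤last)) =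
    2 + k , w₂vⱼvⱼ₊₁ ≤-refl k+3≤last , abc , inj₁ (lStep ≤-refl k+2≤last)
  neighbourClosed-w₁w₂v₁ refl 2nd _ (below (closingTriangle ()))
  neighbourClosed-w₁w₂v₁ refl 2nd v≢2 (between (firstFan _)) = ⊥-elim (v≢2 refl)
  neighbourClosed-w₁w₂v₁ refl 3rd _ (below (hubTriangle _ _)) = 0 , w₀w₁w₂ , cab , inj₂ lStart
  neighbourClosed-w₁w₂v₁ refl 3rd _ (below (closingTriangle ()))
  neighbourClosed-w₁w₂v₁ refl 3rd _ (below (middleFan (s≤s ()) _))
  neighbourClosed-w₁w₂v₁ refl 3rd _ (between (firstFan ()))
  neighbourClosed-w₁w₂v₁ refl 3rd v≢k+2 (above (firstFan refl)) = ⊥-elim (v≢k+2 refl)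

  neighbourClosed-w₂vⱼvⱼ₊₁ : (k+2≤t : 2 + k ≤ t) (t+1≤last : suc t ≤ last) → NeighbourClosed (w₂vⱼvⱼ₊₁ k+2≤t t+1≤last)
  neighbourClosed-w₂vⱼvⱼ₊₁ k+2≤t@(s≤s (s≤s (s≤s (s≤s (s≤s _))))) t+1≤last = closed
    where
    closed : NeighbourClosed (w₂vⱼvⱼ₊₁ k+2≤t t+1≤last)
    closed 1st _ (below (hubTriangle _ t≤k)) = ⊥-elim (<⇒≱ k+2≤t (≤-trans t≤k (n≤1+n _)))
    closed 1st v≢2 (below (middleFan _ _)) = ⊥-elim (v≢2 refl)
    closed 2nd _ (below (firstFan t+1≡k+2)) = ⊥-elim (<⇒≢ k+2≤t (sym (suc-injective t+1≡k+2)))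
    closed 2nd v≢t (between (middleFan _ _)) = ⊥-elim (v≢t refl)
    closed 2nd _ (between (lastFan t+1≡last)) =
      _ , w₂w₃vₗ₋₂ t+1≡last , acb , inj₁ (lStep (≤-trans (n≤1+n _) k+2≤t) t+1≤last)
    closed 2nd _ (above (middleFan _ t+2≤last)) =
      _ , w₂vⱼvⱼ₊₁ (≤-trans k+2≤t (n≤1+n _)) t+2≤last , abc , inj₁ (lStep (≤-trans (n≤1+n _) k+2≤t) t+1≤last)
    closed 3rd _ (below (firstFan refl)) = suc k , w₁w₂v₁ refl , cab , inj₂ (lStep ≤-refl k+2≤last)
    closed 3rd _ (between (middleFan k+2≤v v+1≤last)) =
      _ , w₂vⱼvⱼ₊₁ k+2≤v v+1≤last , acb , inj₂ (lStep (≤-trans (n≤1+n _) k+2≤v) v+1≤last)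
    closed 3rd _ (between (lastFan t≡last)) = ⊥-elim (<⇒≢ t+1≤last t≡last)
    closed 3rd v≢t+1 (above (middleFan _ _)) = ⊥-elim (v≢t+1 refl)

  neighbourClosed-w₂w₃vₗ₋₂ : (t≡last : t ≡ last) → NeighbourClosed (w₂w₃vₗ₋₂ t≡last)
  neighbourClosed-w₂w₃vₗ₋₂ 4≡last 1st _ (below (hubTriangle _ _)) = ⊥-elim (small≢last ≤-refl 4≡last)
  neighbourClosed-w₂w₃vₗ₋₂ _ 1st _ (below (middleFan (s≤s (s≤s (s≤s ()))) _))
  neighbourClosed-w₂w₃vₗ₋₂ _ 1st v≢2 (below (lastFan _)) = ⊥-elim (v≢2 refl)
  neighbourClosed-w₂w₃vₗ₋₂ _ 2nd _ (below (middleFan (s≤s (s≤s ())) _))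
  neighbourClosed-w₂w₃vₗ₋₂ 3≡last 2nd _ (below (hubTriangle _ _)) = ⊥-elim (small≢last (s≤s (s≤s (s≤s z≤n))) 3≡last)
  neighbourClosed-w₂w₃vₗ₋₂ _ 2nd _ (below (firstFan refl)) = suc k , w₁w₂v₁ refl , cab , inj₂ (lStep ≤-refl k+2≤last)
  neighbourClosed-w₂w₃vₗ₋₂ _ 2nd _ (between (middleFan k+2≤v v+1≤last)) =
    _ , w₂vⱼvⱼ₊₁ k+2≤v v+1≤last , acb , inj₂ (lStep (≤-trans (n≤1+n _) k+2≤v) v+1≤last)
  neighbourClosed-w₂w₃vₗ₋₂ _ 2nd v≢3 (between (lastFan _)) = ⊥-elim (v≢3 refl)
  neighbourClosed-w₂w₃vₗ₋₂ t≡last 2nd _ (above (middleFan _ t+1≤last)) = ⊥-elim (<⇒≢ t+1≤last t≡last)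
  neighbourClosed-w₂w₃vₗ₋₂ 3≡last 2nd _ (above (lastFan _)) = ⊥-elim (small≢last (s≤s (s≤s (s≤s z≤n))) 3≡last)
  neighbourClosed-w₂w₃vₗ₋₂ t≡last 3rd _ (below (hubTriangle _ _)) =
    1 , w₀w₂w₃ , cab , inj₁ (subst (λ z → θ z 1) (sym t≡last) lEnd)
  neighbourClosed-w₂w₃vₗ₋₂ _ 3rd _ (below (firstFan ()))
  neighbourClosed-w₂w₃vₗ₋₂ _ 3rd _ (below (middleFan (s≤s (s≤s ())) _))
  neighbourClosed-w₂w₃vₗ₋₂ _ 3rd _ (between (middleFan (s≤s (s≤s ())) _))
  neighbourClosed-w₂w₃vₗ₋₂ _ 3rd _ (between (lastFan 3≡last)) = ⊥-elim (small≢last (s≤s (s≤s (s≤s z≤n))) 3≡last)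
  neighbourClosed-w₂w₃vₗ₋₂ _ 3rd _ (above (middleFan (s≤s (s≤s (s≤s ()))) _))
  neighbourClosed-w₂w₃vₗ₋₂ t≡last 3rd v≢t (above (lastFan v≡last)) = ⊥-elim (v≢t (trans v≡last (sym t≡last)))

  neighbourClosed : (vx : Label x) → NeighbourClosed vx
  neighbourClosed w₀w₁w₂ = neighbourClosed-w₀w₁w₂
  neighbourClosed w₀w₂w₃ = neighbourClosed-w₀w₂w₃
  neighbourClosed w₀w₁wₖ₊₁ = neighbourClosed-w₀w₁wₖ₊₁
  neighbourClosed (w₀wᵢwᵢ₊₁ s r s+r≡m) = neighbourClosed-w₀wᵢwᵢ₊₁ s r s+r≡m
  neighbourClosed (w₁w₂v₁ t≡k+1) = neighbourClosed-w₁w₂v₁ t≡k+1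
  neighbourClosed (w₂vⱼvⱼ₊₁ k+2≤t t+1≤last) = neighbourClosed-w₂vⱼvⱼ₊₁ k+2≤t t+1≤last
  neighbourClosed (w₂w₃vₗ₋₂ t≡last) = neighbourClosed-w₂w₃vₗ₋₂ t≡last

  private
    fanStep : ∀ {a} → suc k ≤ a → suc a ≤ last →
              ∃₂ λ (va : Label a) (va′ : Label (suc a)) → ShareEdge (triangleOf va) (triangleOf va′)
    fanStep {a} k+1≤a a+1≤last with a ≟ suc k | suc (suc a) ≤? last
    ... | yes refl | yes k+3≤last = w₁w₂v₁ refl , w₂vⱼvⱼ₊₁ ≤-refl k+3≤last , 2 , 2 + k , 1 , 3 + k , bca , abc , λ ()
    ... | yes refl | no k+3≰last =
      w₁w₂v₁ refl , w₂w₃vₗ₋₂ (≤-antisym a+1≤last (≮⇒≥ k+3≰last)) , 2 , 2 + k , 1 , 3 , bca , acb , λ ()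
    ... | no a≢k+1 | yes a+2≤last =
      w₂vⱼvⱼ₊₁ k+2≤a a+1≤last , w₂vⱼvⱼ₊₁ (≤-trans k+2≤a (n≤1+n _)) a+2≤last , 2 , suc a , a , 2 + a , acb , abc ,
      <⇒≢ (<-trans (n<1+n a) (n<1+n (suc a)))
      where k+2≤a = ≤∧≢⇒< k+1≤a (a≢k+1 ∘ sym)
    ... | no a≢k+1 | no a+2≰last =
      w₂vⱼvⱼ₊₁ k+2≤a a+1≤last , w₂w₃vₗ₋₂ (≤-antisym a+1≤last (≮⇒≥ a+2≰last)) , 2 , suc a , a , 3 , acb , acb ,
      (<⇒≢ (<-≤-trans (s≤s (s≤s (s≤s (s≤s z≤n)))) k+2≤a) ∘ sym)
      where k+2≤a = ≤∧≢⇒< k+1≤a (a≢k+1 ∘ sym)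

  theta⇒shareEdge : ∀ {y} → θ x y → ∃₂ λ (vx : Label x) (vy : Label y) → ShareEdge (triangleOf vx) (triangleOf vy)
  theta⇒shareEdge direct = w₀w₁w₂ , w₀w₂w₃ , 0 , 2 , 1 , 3 , acb , abc , λ ()
  theta⇒shareEdge kStart = w₀w₁w₂ , w₀w₁wₖ₊₁ , 0 , 1 , 2 , suc k , abc , abc , λ ()
  theta⇒shareEdge (kStep {1} (s≤s ()) _)
  theta⇒shareEdge (kStep {2} _ _) = w₀w₁wₖ₊₁ , w₀wᵢwᵢ₊₁ 0 m refl , 0 , suc k , 1 , k , acb , acb , λ ()
  theta⇒shareEdge (kStep {suc (suc (suc s))} _ 4+s≤k) =
    w₀wᵢwᵢ₊₁ s (suc r) (trans (+-suc s r) s+1+r≡m) , w₀wᵢwᵢ₊₁ (suc s) r s+1+r≡m ,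
    0 , 4 + r , 5 + r , 3 + r , abc , acb , λ e → <-irrefl (sym e) (<-trans (n<1+n _) (n<1+n _))
    where
    r = m ∸ suc s
    s+1+r≡m : suc s + r ≡ m
    s+1+r≡m = m+[n∸m]≡n (+-cancelˡ-≤ 3 (suc s) m 4+s≤k)
  theta⇒shareEdge kEnd = w₀wᵢwᵢ₊₁ m 0 (+-identityʳ m) , w₀w₂w₃ , 0 , 3 , 4 , 2 , abc , acb , λ ()
  theta⇒shareEdge lStart = w₀w₁w₂ , w₁w₂v₁ refl , 1 , 2 , 0 , 2 + k , bca , abc , λ ()
  theta⇒shareEdge (lStep k+1≤a a+1≤last) = fanStep k+1≤a a+1≤last
  theta⇒shareEdge lEnd = w₂w₃vₗ₋₂ refl , w₀w₂w₃ , 2 , 3 , last , 0 , abc , bca , λ ()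

  thetaAdj⇒slide : ∀ i j → ThetaAdj k ℓ i j → SlideAdj G (family i) (family j)
  thetaAdj⇒slide i j θij = shareEdge⇒slide (triangleAt-isTriangle i) (triangleAt-isTriangle j) (shared θij)
    where
    fromLabels : ∀ {i j} (vi : Label (toℕ i)) (vj : Label (toℕ j)) →
                 ShareEdge (triangleOf vi) (triangleOf vj) → ShareEdge (triangleAt i) (triangleAt j)
    fromLabels vi vj = subst₂ ShareEdge (sym (triangleAt-label vi refl)) (sym (triangleAt-label vj refl))
    shared : ThetaAdj k ℓ i j → ShareEdge (triangleAt i) (triangleAt j)
    shared (inj₁ e) = let (vi , vj , s) = theta⇒shareEdge e in fromLabels vi vj s
    shared (inj₂ e) = let (vj , vi , s) = theta⇒shareEdge e in fromLabels vi vj (ShareEdge-sym s)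

  slide⇒thetaAdj : ∀ i j → SlideAdj G (family i) (family j) → ThetaAdj k ℓ i j
  slide⇒thetaAdj i j slide =
    fromNeighbour (neighbourClosed vi old∈T new≢old
                     (completion (others-edge (triangleAt-sorted i) old∈T) (proj₁ new-adjacent) (proj₂ new-adjacent)))
    where
    vi = label (toℕ i) (toℕ<n i)
    open Replacement (slide⇒replacement (triangleAt-isTriangle i) (triangleAt-isTriangle j) slide)
    fromNeighbour : ThetaNeighbour (toℕ i) (replace (triangleAt i) old∈T new) → ThetaAdj k ℓ i j
    fromNeighbour (y , w , π , θiy) = subst (λ z → θ (toℕ i) z ⊎ θ z (toℕ i)) (sym j≡y) θiy
      where
      j≡y : toℕ j ≡ y
      j≡y = triangleOf-injective (label (toℕ j) (toℕ<n j)) w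
              (increasing-≈₃⇒≡ (triangle-increasing (triangleAt-sorted j)) (triangle-increasing (triangleOf-sorted w))
                               (≈₃-trans T′≈ (↭₃⇒≈₃ π)))

mainTheorem15 : (k ℓ : ℕ) → 3 ≤ k → k ≤ ℓ →
    ((X : Subset (k + ℓ)) → IsISet (GAdj k ℓ) X ⇔ IsAlphaSet (GAdj k ℓ) X)
    × Σ (Fin (k + ℓ) → Subset (k + ℓ)) (λ f →
        ((a : Fin (k + ℓ)) → IsISet (GAdj k ℓ) (f a))
        × Injective _≡_ _≡_ f
        × ((X : Subset (k + ℓ)) → IsISet (GAdj k ℓ) X → ∃ λ a → f a ≡ X)
        × ((a b : Fin (k + ℓ)) → ThetaAdj k ℓ a b ⇔ SlideAdj (GAdj k ℓ) (f a) (f b)))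
mainTheorem15 (suc (suc (suc m))) (suc (suc (suc n))) (s≤s (s≤s (s≤s z≤n))) (s≤s (s≤s (s≤s _))) =
  iSet⇔alphaSet , family , family-isISet , family-injective ,
  (λ X iX → indepDominating⇒family (proj₁ iX)) ,
  λ i j → mk⇔ (thetaAdj⇒slide i j) (slide⇒thetaAdj i j)
  where
  open WheelWithFan m n
  open CoveringFamily G family family-indepDominating ∣family∣≡3 family-covers
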